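{- Let $G=(V,E)$ be a graph, $X$ a feedback vertex set of $G$, and suppose there is a maximum overlap solution $X'$ with respect to $X$ such that $X\cap X'=R$, where $R\subseteq X$ is given. Let $S=X\setminus R$. Then the number of core vertices, i.e. $|V(\mathrm{reduced}(R))\setminus S|$, is at most $13|S|$.
   Context: A feedback vertex set of a (multi)graph is a vertex set whose removal leaves a forest (a multigraph with parallel edges contains a cycle). A maximum overlap solution with respect to a feedback vertex set $X$ of $G$ is a minimum feedback vertex set $X'$ of $G$ for which $|X\cap X'|$ is maximum among all minimum feedback vertex sets. For $R\subseteq X$ and $S=X\setminus R$, $\mathrm{reduced}(R)$ is the multigraph obtained from $G[V\setminus R]$ by exhaustively applying the rules: (1) if a vertex $v\notin S$ has degree 1, delete $v$; (2) if a vertex $v\notin S$ has degree 2, delete $v$ and join its two neighbors by a new edge (possibly creating parallel edges). -}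

module Defs where

open import Data.Nat using (ℕ; zero; suc; _+_; _≤_)
open import Data.Bool using (Bool; true; false)
open import Data.Fin using (Fin; zero; suc; inject₁; fromℕ; _≟_)
open import Data.Fin.Subset using (Subset; _∈_; _∉_; _∩_; _─_; ∣_∣; ⁅_⁆; ∁)
open import Data.Vec using (lookup)
open import Data.List using (List; []; _∷_; length)
import Data.List as List
open import Data.List.Relation.Unary.All using (All)
open import Data.List.Relation.Binary.Permutation.Propositional using (_↭_)
open import Data.Product using (_×_; _,_; proj₁; proj₂; Σ; ∃)
open import Data.Sum using (_⊎_)
open import Function.Definitions using (Injective)
open import Relation.Nullary using (¬_; yes; no)
open import Relation.Binary.PropositionalEquality using (_≡_; _≢_)
open import Relation.Binary.Construct.Closure.ReflexiveTransitive using (Star)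

-- An edge is an (unordered) pair of vertices, represented by an ordered pair.
Edge : ℕ → Set
Edge n = Fin n × Fin n

Joins : ∀ {n} → Edge n → Fin n → Fin n → Set
Joins e x y = (e ≡ (x , y)) ⊎ (e ≡ (y , x))

Incident : ∀ {n} → Fin n → Edge n → Set
Incident v e = (proj₁ e ≡ v) ⊎ (proj₂ e ≡ v)

-- A finite simple graph on vertex set Fin n, given by its edge list:
-- no loops and no two list positions carry the same unordered pair.
SimpleGraph : ∀ {n} → List (Edge n) → Set
SimpleGraph E =
  (∀ i → proj₁ (List.lookup E i) ≢ proj₂ (List.lookup E i)) ×
  (∀ i j → Joins (List.lookup E i) (proj₁ (List.lookup E j)) (proj₂ (List.lookup E j)) → i ≡ j)

-- A cycle in the multigraph with vertex set A and edge (multi)set es: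
-- distinct vertices v₀ … v_k (k ≥ 0) and distinct edges e₀ … e_k with
-- e_i joining v_i and v_{i+1}, and e_k joining v_k and v₀.
-- (k = 0 : a loop; k = 1 : two parallel edges.)
record Cycle {n} (A : Subset n) (es : List (Edge n)) : Set where
  field
    k       : ℕ
    vs      : Fin (suc k) → Fin n
    vs-inj  : Injective _≡_ _≡_ vs
    vs-in   : ∀ i → vs i ∈ A
    ed      : Fin (suc k) → Fin (length es)
    ed-inj  : Injective _≡_ _≡_ ed
    ed-step : ∀ (i : Fin k) → Joins (List.lookup es (ed (inject₁ i))) (vs (inject₁ i)) (vs (suc i))
    ed-close : Joins (List.lookup es (ed (fromℕ k))) (vs (fromℕ k)) (vs zero)

IsFVS : ∀ {n} → List (Edge n) → Subset n → Set
IsFVS E Y = ¬ Cycle (∁ Y) E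

IsMinFVS : ∀ {n} → List (Edge n) → Subset n → Set
IsMinFVS E Y = IsFVS E Y × (∀ Z → IsFVS E Z → ∣ Y ∣ ≤ ∣ Z ∣)

IsMaxOverlap : ∀ {n} → List (Edge n) → Subset n → Subset n → Set
IsMaxOverlap E X X' = IsMinFVS E X' × (∀ Z → IsMinFVS E Z → ∣ X ∩ Z ∣ ≤ ∣ X ∩ X' ∣)

-- Multigraphs whose vertex set is a subset of Fin n.
record MG (n : ℕ) : Set where
  constructor mg
  field
    alive : Subset n
    edges : List (Edge n)
open MG public

keepOutside : ∀ {n} → Subset n → List (Edge n) → List (Edge n)
keepOutside R [] = []
keepOutside R ((u , v) ∷ es) with lookup R u | lookup R v
... | false | false = (u , v) ∷ keepOutside R es
... | _     | _     = keepOutside R es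

induced : ∀ {n} → List (Edge n) → Subset n → MG n
induced E R = mg (∁ R) (keepOutside R E)

-- degree (a loop contributes 2)
deg : ∀ {n} → Fin n → List (Edge n) → ℕ
deg v [] = 0
deg v ((a , b) ∷ es) = c a + c b + deg v es
  where
  c : _ → ℕ
  c x with x ≟ v
  ... | yes _ = 1
  ... | no _  = 0

dropIncident : ∀ {n} → Fin n → List (Edge n) → List (Edge n)
dropIncident v [] = []
dropIncident v ((a , b) ∷ es) with a ≟ v | b ≟ v
... | no _ | no _ = (a , b) ∷ dropIncident v es
... | _    | _    = dropIncident v es

data Step {n} (S : Subset n) : MG n → MG n → Set where
  rule1 : ∀ {A es} v → v ∈ A → v ∉ S → deg v es ≤ 1 →
          Step S (mg A es) (mg (A ─ ⁅ v ⁆) (dropIncident v es))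
  -- rule (2): a vertex v ∉ S of degree 2 with edges to neighbours a, b
  -- (a = b allowed): delete v and join a and b by a new edge
  rule2 : ∀ {A es rest e₁ e₂} v a b → v ∈ A → v ∉ S →
          es ↭ (e₁ ∷ e₂ ∷ rest) → Joins e₁ v a → Joins e₂ v b →
          a ≢ v → b ≢ v → All (λ e → ¬ Incident v e) rest →
          Step S (mg A es) (mg (A ─ ⁅ v ⁆) ((a , b) ∷ rest))

IsReduced : ∀ {n} → List (Edge n) → Subset n → Subset n → MG n → Set
IsReduced E R S H = Star (Step S) (induced E R) H × (∀ H' → ¬ Step S H H')

-- Run the reduction step by step, carrying along a feedback vertex set W of the current
-- multigraph with ∣W∣ ≤ ∣X′ ∖ R∣ ≤ ∣S∣: start from X′ ∖ R, and when rule (2) deletes a vertex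
-- of W, put one of its two neighbours in its place. A cycle of the reduced multigraph H lifts
-- to a cycle of G whose other vertices were deleted and lie outside R, and cycles of G − R
-- survive in H. Hence W ∪ R is a feedback vertex set of G of size at most ∣X′∣, so it is
-- minimum, and maximality of the overlap ∣X ∩ X′∣ = ∣R∣ forces W to avoid X, in particular S.
-- In H every vertex outside S has degree at least 3, since otherwise a rule would apply, or a
-- loop would give a cycle of G avoiding X. Counting the edges of the forests H − W and H − S
-- gives ∣V(H) ∖ S∣ ≤ ∣S∣ + 2∣W∣ ≤ 3∣S∣.

module Submission where

open import Defs
open import Data.Nat using (ℕ; _≤_; _*_)
open import Data.Fin.Subset using (Subset; _⊆_; _∩_; _─_; ∣_∣)
open import Data.List using (List)
open import Data.Product using (_×_; ∃)
open import Relation.Binary.PropositionalEquality using (_≡_)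

open import Data.Nat as ℕ using (zero; suc; _+_; _<_; z≤n; s≤s)
import Data.Nat.Properties as ℕP
open import Data.Bool using (Bool; true; false; not; _∧_; _∨_)
import Data.Bool.Properties as BoolP
open import Data.Fin as Fin using (Fin; zero; suc; inject₁; fromℕ)
import Data.Fin.Properties as FinP
open import Data.Fin.Subset using (_∈_; _∉_; ∁; ⁅_⁆; _∪_; _-_)
open import Data.Fin.Subset.Properties
  using (_∈?_; p⊂q⇒∣p∣<∣q∣; p─q⊆p; p─q─r≡p─r─q; x∈p∧x∉q⇒x∈p─q; x∈p∧x≢y⇒x∈p-y; x∈p∩q⁺; x∈p∩q⁻;
         x∈p∪q⁺; x∈p∪q⁻; x∈⁅x⁆; x∈⁅y⁆⇒x≡y; x∈∁p⇒x∉p; x∉p⇒x∈∁p; ∣p─q∣≤∣p∣; ∣⁅x⁆∣≡1)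
import Data.Vec as Vec
import Data.Vec.Properties as VecP
open import Data.List as List using ([]; _∷_; length; _++_; [_]; _∷ʳ_)
import Data.List.Properties as ListP
open import Data.List.Membership.Propositional using (find) renaming (_∈_ to _∈ˡ_; _∉_ to _∉ˡ_)
open import Data.List.Membership.Propositional.Properties using (∈-lookup; ∈-∃++; ∈-++⁺ʳ; ∈-++⁻; ∈-map⁺)
open import Data.List.Relation.Unary.All as All using (All; []; _∷_)
import Data.List.Relation.Unary.All.Properties as AllP
open import Data.List.Relation.Unary.Any as Any using (Any; here; there)
import Data.List.Relation.Unary.Any.Properties as AnyP
open import Data.List.Relation.Unary.Unique.Propositional using (Unique)
open import Data.List.Relation.Unary.AllPairs using ([]; _∷_)
import Data.List.Relation.Unary.Unique.Propositional.Properties as UniqueP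
open import Data.List.Relation.Binary.Permutation.Propositional as Perm using (_↭_; ↭-sym; ↭⇒↭ₛ)
import Data.List.Relation.Binary.Permutation.Propositional.Properties as PermP
import Data.List.Relation.Binary.Permutation.Setoid as PermSetoid
import Data.List.Relation.Binary.Permutation.Setoid.Properties as PermSetoidP
open import Data.Product as Product using (Σ; _,_; proj₁; proj₂; ∃-syntax)
open import Data.Sum as Sum using (_⊎_; inj₁; inj₂)
open import Function using (_∘_; id; case_of_; Inverse; Injection)
open import Function.Properties.Inverse using (↔⇒↣)
open import Relation.Nullary using (¬_; Dec; yes; no; _×-dec_; _⊎-dec_; ¬?; contradiction)
open import Relation.Unary using (Decidable)
open import Data.Unit using (⊤; tt)
open import Relation.Binary.PropositionalEquality as ≡
  using (refl; sym; trans; cong; cong₂; subst; subst₂; _≢_)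
open import Relation.Binary.Construct.Closure.ReflexiveTransitive using (Star; ε; _◅_)
open import Data.Nat.Tactic.RingSolver using (solve-∀)
open import Algebra.Properties.Semiring.Sum ℕP.+-*-semiring using (sum; sum-cong-≗; ∑-distrib-+; *-distribˡ-sum)

module _ {a} {A : Set a} where

  ∷-unique : ∀ {x} {xs : List A} → x ∉ˡ xs → Unique xs → Unique (x ∷ xs)
  ∷-unique {xs = xs} x∉xs u = AllP.¬Any⇒All¬ xs x∉xs ∷ u

  lookup-injective : ∀ {b} {B : Set b} (f : A → B) {xs : List A} → Unique (List.map f xs) →
                     ∀ i j → f (List.lookup xs i) ≡ f (List.lookup xs j) → i ≡ j
  lookup-injective f {_ ∷ _} _ zero zero _ = refl
  lookup-injective f {_ ∷ _} (x≢ ∷ _) zero (suc j) eq = contradiction eq (All.lookup x≢ (∈-map⁺ f (∈-lookup j)))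
  lookup-injective f {_ ∷ _} (x≢ ∷ _) (suc i) zero eq = contradiction (sym eq) (All.lookup x≢ (∈-map⁺ f (∈-lookup i)))
  lookup-injective f {_ ∷ _} (_ ∷ u) (suc i) (suc j) eq = cong suc (lookup-injective f u i j eq)

  snocView : ∀ (x : A) xs → ∃[ ini ] ∃[ y ] x ∷ xs ≡ ini ∷ʳ y
  snocView x [] = [] , x , refl
  snocView x (y ∷ xs) with snocView y xs
  ... | ini , z , eq = x ∷ ini , z , cong (x ∷_) eq

  unique-resp-↭ : ∀ {xs ys : List A} → xs ↭ ys → Unique xs → Unique ys
  unique-resp-↭ p = PermSetoidP.Unique-resp-↭ (≡.setoid A) (↭⇒↭ₛ p)

  unique-++-comm : ∀ (xs : List A) {ys} → Unique (xs ++ ys) → Unique (ys ++ xs)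
  unique-++-comm xs {ys} = unique-resp-↭ (PermP.++-comm xs ys)

  unique-++⁻ʳ : ∀ (xs : List A) {ys} → Unique (xs ++ ys) → Unique ys
  unique-++⁻ʳ [] u = u
  unique-++⁻ʳ (_ ∷ xs) (_ ∷ u) = unique-++⁻ʳ xs u

  unique-++⁻ˡ : ∀ (xs : List A) {ys} → Unique (xs ++ ys) → Unique xs
  unique-++⁻ˡ xs {ys} u = unique-++⁻ʳ ys (unique-++-comm xs u)

  unique-++-disjoint : ∀ (xs : List A) {ys x} → Unique (xs ++ ys) → x ∈ˡ xs → x ∉ˡ ys
  unique-++-disjoint (_ ∷ xs) (x≢ ∷ _) (here refl) x∈ys = AllP.All¬⇒¬Any (AllP.++⁻ʳ xs x≢) x∈ys
  unique-++-disjoint (_ ∷ xs) (_ ∷ u) (there x∈xs) = unique-++-disjoint xs u x∈xs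

  ∷ʳ-unique : ∀ {xs : List A} {x} → x ∉ˡ xs → Unique xs → Unique (xs ∷ʳ x)
  ∷ʳ-unique {xs} x∉xs u = unique-++-comm [ _ ] (∷-unique x∉xs u)

unique-length≤ : ∀ {n} (xs : List (Fin n)) → Unique xs → length xs ≤ n
unique-length≤ {n} xs u with length xs ℕ.≤? n
... | yes ≤n = ≤n
... | no ≰n with FinP.pigeonhole (ℕP.≰⇒> ≰n) (List.lookup xs)
... | i , j , i<j , eq =
  contradiction (lookup-injective id (subst Unique (sym (ListP.map-id xs)) u) i j eq) (FinP.<⇒≢ i<j)

sum-mono-≤ : ∀ {k} {f g : Fin k → ℕ} → (∀ i → f i ≤ g i) → sum f ≤ sum g
sum-mono-≤ {zero} h = z≤n
sum-mono-≤ {suc k} h = ℕP.+-mono-≤ (h zero) (sum-mono-≤ (h ∘ suc))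

sum-zero : ∀ k → sum {k} (λ _ → 0) ≡ 0
sum-zero zero = refl
sum-zero (suc k) = sum-zero k

δ : ∀ {k} → Fin k → Fin k → ℕ
δ i j with i Fin.≟ j
... | yes _ = 1
... | no _ = 0

δ-refl : ∀ {k} (i : Fin k) → δ i i ≡ 1
δ-refl i with i Fin.≟ i
... | yes _ = refl
... | no i≢i = contradiction refl i≢i

δ-≢ : ∀ {k} {i j : Fin k} → i ≢ j → δ i j ≡ 0
δ-≢ {i = i} {j} i≢j with i Fin.≟ j
... | yes i≡j = contradiction i≡j i≢j
... | no _ = refl

sum-*δ : ∀ {k} (f : Fin k → ℕ) i → sum (λ j → f j * δ i j) ≡ f i
sum-*δ {suc k} f zero = begin
  f zero * 1 + sum (λ j → f (suc j) * 0) ≡⟨ cong₂ _+_ (ℕP.*-identityʳ (f zero))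
                                                       (sum-cong-≗ (ℕP.*-zeroʳ ∘ f ∘ suc)) ⟩
  f zero + sum {k} (λ _ → 0)             ≡⟨ cong (f zero +_) (sum-zero k) ⟩
  f zero + 0                             ≡⟨ ℕP.+-identityʳ (f zero) ⟩
  f zero                                 ∎
  where open ≡.≡-Reasoning
sum-*δ {suc k} f (suc i) = begin
  f zero * 0 + sum (λ j → f (suc j) * δ (suc i) (suc j)) ≡⟨ cong₂ _+_ (ℕP.*-zeroʳ (f zero))
                                                           (sum-cong-≗ (λ j → cong (f (suc j) *_) (δ-suc i j))) ⟩
  sum (λ j → f (suc j) * δ i j)                            ≡⟨ sum-*δ (f ∘ suc) i ⟩
  f (suc i)                                                ∎
  where
  open ≡.≡-Reasoning
  δ-suc : ∀ {k} (i j : Fin k) → δ (suc i) (suc j) ≡ δ i j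
  δ-suc i j with i Fin.≟ j
  ... | yes _ = refl
  ... | no _ = refl

sum-δ : ∀ {k} (i : Fin k) → sum (δ i) ≡ 1
sum-δ i = trans (sum-cong-≗ (λ j → sym (ℕP.*-identityˡ (δ i j)))) (sum-*δ (λ _ → 1) i)

lookup-─ : ∀ {k} (p q : Subset k) x → Vec.lookup (p ─ q) x ≡ Vec.lookup p x ∧ not (Vec.lookup q x)
lookup-─ (b Vec.∷ p) (true Vec.∷ q) zero = sym (BoolP.∧-zeroʳ b)
lookup-─ (b Vec.∷ p) (false Vec.∷ q) zero = sym (BoolP.∧-identityʳ b)
lookup-─ (_ Vec.∷ p) (_ Vec.∷ q) (suc x) = lookup-─ p q x

bit : Bool → ℕ
bit true = 1
bit false = 0

∉⇒lookup≡false : ∀ {n x} {p : Subset n} → x ∉ p → Vec.lookup p x ≡ false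
∉⇒lookup≡false {x = x} {p} x∉p with Vec.lookup p x in eq
... | true = contradiction (VecP.lookup⇒[]= x p eq) x∉p
... | false = refl

χ : ∀ {n} → Subset n → Fin n → ℕ
χ p x = bit (Vec.lookup p x)

∣p∣≡sum-χ : ∀ {n} (p : Subset n) → ∣ p ∣ ≡ sum (χ p)
∣p∣≡sum-χ Vec.[] = refl
∣p∣≡sum-χ (true Vec.∷ p) = cong suc (∣p∣≡sum-χ p)
∣p∣≡sum-χ (false Vec.∷ p) = ∣p∣≡sum-χ p

module _ {n : ℕ} where

  ∈⇒χ≡1 : ∀ {x} {p : Subset n} → x ∈ p → χ p x ≡ 1
  ∈⇒χ≡1 x∈p = cong bit (VecP.[]=⇒lookup x∈p)

  ∉⇒χ≡0 : ∀ {x} {p : Subset n} → x ∉ p → χ p x ≡ 0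
  ∉⇒χ≡0 x∉p = cong bit (∉⇒lookup≡false x∉p)

  x∈p─q⇒x∉q : ∀ {p q : Subset n} {x} → x ∈ p ─ q → x ∉ q
  x∈p─q⇒x∉q {p} {q} {x} x∈p─q x∈q with trans (sym (lookup-─ p q x)) (VecP.[]=⇒lookup x∈p─q)
  ... | eq rewrite VecP.[]=⇒lookup x∈q | BoolP.∧-zeroʳ (Vec.lookup p x) = case eq of λ ()

  x∈p─q⁻ : ∀ {p q : Subset n} {x} → x ∈ p ─ q → x ∈ p × x ∉ q
  x∈p─q⁻ {p} {q} x∈p─q = p─q⊆p p q x∈p─q , x∈p─q⇒x∉q x∈p─q

  x∈p-y⁻ : ∀ {p : Subset n} {x y} → x ∈ p - y → x ∈ p × x ≢ y
  x∈p-y⁻ {p} {y = y} x∈p-y = p─q⊆p p ⁅ y ⁆ x∈p-y , λ { refl → x∈p─q⇒x∉q x∈p-y (x∈⁅x⁆ y) }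

  p-x⊆q-x : ∀ {p q : Subset n} {x} → p ⊆ q → p - x ⊆ q - x
  p-x⊆q-x p⊆q y∈p-x = let y∈p , y≢x = x∈p-y⁻ y∈p-x in x∈p∧x≢y⇒x∈p-y (p⊆q y∈p) y≢x

  ∈p-x∧∉q-x⇒∈p∧∉q : ∀ {p q : Subset n} {x y} → y ∈ p - x × y ∉ q - x → y ∈ p × y ∉ q
  ∈p-x∧∉q-x⇒∈p∧∉q (y∈p-x , y∉q-x) =
    let y∈p , y≢x = x∈p-y⁻ y∈p-x in y∈p , (λ y∈q → y∉q-x (x∈p∧x≢y⇒x∈p-y y∈q y≢x))

  sum-χ+χ : ∀ (p q : Subset n) → sum (λ x → χ p x + χ q x) ≡ ∣ p ∣ + ∣ q ∣
  sum-χ+χ p q = trans (∑-distrib-+ (χ p) (χ q)) (sym (cong₂ _+_ (∣p∣≡sum-χ p) (∣p∣≡sum-χ q)))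

  card-+ : ∀ (p q r : Subset n) → (∀ x → χ p x ≡ χ q x + χ r x) → ∣ p ∣ ≡ ∣ q ∣ + ∣ r ∣
  card-+ p q r h = trans (∣p∣≡sum-χ p) (trans (sum-cong-≗ h) (sum-χ+χ q r))

  card-≤-+ : ∀ (p q r : Subset n) → (∀ x → χ p x ≤ χ q x + χ r x) → ∣ p ∣ ≤ ∣ q ∣ + ∣ r ∣
  card-≤-+ p q r h =
    ℕP.≤-trans (ℕP.≤-reflexive (∣p∣≡sum-χ p)) (ℕP.≤-trans (sum-mono-≤ h) (ℕP.≤-reflexive (sum-χ+χ q r)))

  ∣p∣≡∣p─q∣+∣q∣ : ∀ {p q : Subset n} → q ⊆ p → ∣ p ∣ ≡ ∣ p ─ q ∣ + ∣ q ∣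
  ∣p∣≡∣p─q∣+∣q∣ {p} {q} q⊆p = card-+ p (p ─ q) q pointwise
    where
    pointwise : ∀ x → χ p x ≡ χ (p ─ q) x + χ q x
    pointwise x rewrite lookup-─ p q x with Vec.lookup q x in eq
    ... | true rewrite VecP.[]=⇒lookup (q⊆p (VecP.lookup⇒[]= x q eq)) = refl
    ... | false rewrite BoolP.∧-identityʳ (Vec.lookup p x) = sym (ℕP.+-identityʳ _)

  ∣p∣≡1+∣p-x∣ : ∀ {p : Subset n} {x} → x ∈ p → ∣ p ∣ ≡ suc ∣ p - x ∣
  ∣p∣≡1+∣p-x∣ {p} {x} x∈p = begin
    ∣ p ∣                 ≡⟨ ∣p∣≡∣p─q∣+∣q∣ (λ y∈⁅x⁆ → subst (_∈ p) (sym (x∈⁅y⁆⇒x≡y x y∈⁅x⁆)) x∈p) ⟩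
    ∣ p - x ∣ + ∣ ⁅ x ⁆ ∣ ≡⟨ cong (∣ p - x ∣ +_) (∣⁅x⁆∣≡1 x) ⟩
    ∣ p - x ∣ + 1         ≡⟨ ℕP.+-comm (∣ p - x ∣) 1 ⟩
    suc ∣ p - x ∣         ∎
    where open ≡.≡-Reasoning

  ∣p∪q∣≤∣p∣+∣q∣ : ∀ (p q : Subset n) → ∣ p ∪ q ∣ ≤ ∣ p ∣ + ∣ q ∣
  ∣p∪q∣≤∣p∣+∣q∣ p q = card-≤-+ (p ∪ q) p q pointwise
    where
    pointwise : ∀ x → χ (p ∪ q) x ≤ χ p x + χ q x
    pointwise x rewrite VecP.lookup-zipWith _∨_ x p q with Vec.lookup p x | Vec.lookup q x
    ... | true | _ = s≤s z≤n
    ... | false | true = s≤s z≤n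
    ... | false | false = z≤n

-- Walks, and cycles presented by their darts

module _ {n : ℕ} where

  joins-incident : ∀ {e : Edge n} {x y u} → Joins e x y → Incident u e → u ≡ x ⊎ u ≡ y
  joins-incident (inj₁ refl) (inj₁ refl) = inj₁ refl
  joins-incident (inj₁ refl) (inj₂ refl) = inj₂ refl
  joins-incident (inj₂ refl) (inj₁ refl) = inj₂ refl
  joins-incident (inj₂ refl) (inj₂ refl) = inj₁ refl

  joins-incidentˡ : ∀ {e : Edge n} {x y} → Joins e x y → Incident x e
  joins-incidentˡ (inj₁ refl) = inj₁ refl
  joins-incidentˡ (inj₂ refl) = inj₂ refl

  joins-incidentʳ : ∀ {e : Edge n} {x y} → Joins e x y → Incident y e
  joins-incidentʳ (inj₁ refl) = inj₂ refl
  joins-incidentʳ (inj₂ refl) = inj₁ refl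

  joins-sym : ∀ {e : Edge n} {x y} → Joins e x y → Joins e y x
  joins-sym (inj₁ eq) = inj₂ eq
  joins-sym (inj₂ eq) = inj₁ eq

  joins-loop : ∀ {e : Edge n} {v} → Joins e v v → e ≡ (v , v)
  joins-loop (inj₁ eq) = eq
  joins-loop (inj₂ eq) = eq

  joins-unique : ∀ {e : Edge n} {v x y} → y ≢ v → Joins e v x → Joins e v y → x ≡ y
  joins-unique y≢v (inj₁ refl) (inj₁ refl) = refl
  joins-unique y≢v (inj₁ refl) (inj₂ refl) = contradiction refl y≢v
  joins-unique y≢v (inj₂ refl) (inj₁ refl) = contradiction refl y≢v
  joins-unique y≢v (inj₂ refl) (inj₂ refl) = refl

  Ends∈ : Subset n → Edge n → Set
  Ends∈ A e = proj₁ e ∈ A × proj₂ e ∈ A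

  joins⇒∈ʳ : ∀ {A} {e : Edge n} {x y} → Ends∈ A e → Joins e x y → y ∈ A
  joins⇒∈ʳ (_ , y∈A) (inj₁ refl) = y∈A
  joins⇒∈ʳ (y∈A , _) (inj₂ refl) = y∈A

  ends∈-remove : ∀ {A} {v} {e : Edge n} → Ends∈ A e → ¬ Incident v e → Ends∈ (A - v) e
  ends∈-remove (a∈A , b∈A) ¬v∈e =
    x∈p∧x≢y⇒x∈p-y a∈A (¬v∈e ∘ inj₁) , x∈p∧x≢y⇒x∈p-y b∈A (¬v∈e ∘ inj₂)

  Pos : List (Edge n) → Set
  Pos es = Fin (length es)

  Dart : List (Edge n) → Set
  Dart es = Fin n × Pos es

  data Walk (es : List (Edge n)) : Fin n → List (Dart es) → Fin n → Set where
    done : ∀ {x} → Walk es x [] x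
    step : ∀ {x y z p ds} → Joins (List.lookup es p) x y → Walk es y ds z →
           Walk es x ((x , p) ∷ ds) z

  Visits : ∀ {X : Set} → Fin n → List (Fin n × X) → Set
  Visits u ds = Any ((u ≡_) ∘ proj₁) ds

  record DartCycle (P : Fin n → Set) (es : List (Edge n)) : Set where
    constructor dartCycle
    field
      d       : Dart es
      ds      : List (Dart es)
      walk    : Walk es (proj₁ d) (d ∷ ds) (proj₁ d)
      uniqueV : Unique (List.map proj₁ (d ∷ ds))
      uniqueE : Unique (List.map proj₂ (d ∷ ds))
      allP    : All (P ∘ proj₁) (d ∷ ds)

  darts : ∀ {P es} → DartCycle P es → List (Dart es)
  darts c = DartCycle.d c ∷ DartCycle.ds c

  walk-++ : ∀ {es a b c xs ys} → Walk es a xs b → Walk es b ys c → Walk es a (xs ++ ys) c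
  walk-++ done w = w
  walk-++ (step j w) w′ = step j (walk-++ w w′)

  walk-split : ∀ {es a c} xs {ys} → Walk es a (xs ++ ys) c → ∃[ b ] Walk es a xs b × Walk es b ys c
  walk-split [] w = _ , done , w
  walk-split (_ ∷ xs) (step j w) with walk-split xs w
  ... | b , w₁ , w₂ = b , step j w₁ , w₂

  walk-lastStep : ∀ {es a c} xs {x p} → Walk es a (xs ∷ʳ (x , p)) c → Joins (List.lookup es p) x c
  walk-lastStep xs w with walk-split xs w
  ... | _ , _ , step j done = j

  walk-joins : ∀ {es x z} d ds → Walk es x (d ∷ ds) z → ∀ (i : Fin (length ds)) →
    Joins (List.lookup es (proj₂ (List.lookup (d ∷ ds) (inject₁ i))))
          (proj₁ (List.lookup (d ∷ ds) (inject₁ i))) (proj₁ (List.lookup (d ∷ ds) (suc i)))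
  walk-joins d (d′ ∷ ds) (step j (step j′ w)) zero = j
  walk-joins d (d′ ∷ ds) (step j w) (suc i) = walk-joins d′ ds w i

  walk-joinsLast : ∀ {es x z} d ds → Walk es x (d ∷ ds) z →
    Joins (List.lookup es (proj₂ (List.lookup (d ∷ ds) (fromℕ (length ds)))))
          (proj₁ (List.lookup (d ∷ ds) (fromℕ (length ds)))) z
  walk-joinsLast d [] (step j done) = j
  walk-joinsLast d (d′ ∷ ds) (step j w) = walk-joinsLast d′ ds w

  walk-tabulate : ∀ {es} k (vs : Fin (suc k) → Fin n) (ps : Fin (suc k) → Pos es) z →
    (∀ (i : Fin k) → Joins (List.lookup es (ps (inject₁ i))) (vs (inject₁ i)) (vs (suc i))) →
    Joins (List.lookup es (ps (fromℕ k))) (vs (fromℕ k)) z →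
    Walk es (vs zero) (List.tabulate (λ i → vs i , ps i)) z
  walk-tabulate zero vs ps z js jₖ = step jₖ done
  walk-tabulate (suc k) vs ps z js jₖ = step (js zero) (walk-tabulate k (vs ∘ suc) (ps ∘ suc) z (js ∘ suc) jₖ)

  toCycle : ∀ {A es} → DartCycle (_∈ A) es → Cycle A es
  toCycle {A} {es} (dartCycle d ds w uV uE aP) = record
    { k = length ds
    ; vs = λ i → proj₁ (List.lookup (d ∷ ds) i)
    ; vs-inj = λ {i} {j} → lookup-injective proj₁ uV i j
    ; vs-in = λ i → All.lookup aP (∈-lookup i)
    ; ed = λ i → proj₂ (List.lookup (d ∷ ds) i)
    ; ed-inj = λ {i} {j} → lookup-injective proj₂ uE i j
    ; ed-step = walk-joins d ds w
    ; ed-close = walk-joinsLast d ds w }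

  fromCycle : ∀ {A es} → Cycle A es → DartCycle (_∈ A) es
  fromCycle {A} {es} c = dartCycle (vs zero , ed zero) (List.tabulate (λ i → vs (suc i) , ed (suc i)))
    (walk-tabulate k vs ed (vs zero) ed-step ed-close)
    (subst Unique (sym (ListP.map-tabulate dart proj₁)) (UniqueP.tabulate⁺ vs-inj))
    (subst Unique (sym (ListP.map-tabulate dart proj₂)) (UniqueP.tabulate⁺ ed-inj))
    (AllP.tabulate⁺ {f = dart} vs-in)
    where
    open Cycle c
    dart : Fin (suc k) → Dart es
    dart i = vs i , ed i

  mapCycle : ∀ {P P′ : Fin n → Set} {es} → (∀ {u} → P u → P′ u) → DartCycle P es → DartCycle P′ es
  mapCycle f (dartCycle d ds w uV uE aP) = dartCycle d ds w uV uE (All.map f aP)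

  visits-self : ∀ {X : Set} (ds : List (Fin n × X)) → All (λ dt → Visits (proj₁ dt) ds) ds
  visits-self [] = []
  visits-self (_ ∷ ds) = here refl ∷ All.map there (visits-self ds)

  restrictCycle : ∀ {P P′ : Fin n → Set} {es} (c : DartCycle P es) → (∀ {u} → Visits u (darts c) → P′ u) →
                  DartCycle (λ u → P u × P′ u) es
  restrictCycle (dartCycle d ds w uV uE aP) f =
    dartCycle d ds w uV uE (All.zip (aP , All.map f (visits-self (d ∷ ds))))

  visits-P : ∀ {P es} (c : DartCycle P es) {u} → Visits u (darts c) → P u
  visits-P c u∈ with find u∈
  ... | _ , dt∈ , refl = All.lookup (DartCycle.allP c) dt∈

  walk-start : ∀ {es y ds z} → Walk es y ds z → Visits y ds ⊎ y ≡ z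
  walk-start done = inj₂ refl
  walk-start (step _ _) = inj₁ (here refl)

  walk-endpoints : ∀ {es a ds z} → Walk es a ds z →
    All (λ dt → ∀ u → Incident u (List.lookup es (proj₂ dt)) → Visits u ds ⊎ u ≡ z) ds
  walk-endpoints done = []
  walk-endpoints {es} (step {x = x} {ds = ds} j w) =
    first ∷ All.map (λ f u i → Sum.map₁ there (f u i)) (walk-endpoints w)
    where
    first : ∀ u → Incident u _ → Visits u ((x , _) ∷ ds) ⊎ u ≡ _
    first u i with joins-incident j i
    ... | inj₁ refl = inj₁ (here refl)
    ... | inj₂ refl = Sum.map₁ there (walk-start w)

  cycle-endpoints : ∀ {P es} (c : DartCycle P es) →
    All (λ dt → ∀ u → Incident u (List.lookup es (proj₂ dt)) → Visits u (darts c)) (darts c)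
  cycle-endpoints c =
    All.map (λ f u i → Sum.[ id , (λ e → here e) ] (f u i)) (walk-endpoints (DartCycle.walk c))

  cycle-edges : ∀ {P es} (c : DartCycle P es) →
                All (λ dt → ∀ u → Incident u (List.lookup es (proj₂ dt)) → P u) (darts c)
  cycle-edges c = All.map (λ ends u u∈e → visits-P c (ends u u∈e)) (cycle-endpoints c)

  walk-incident : ∀ {es a ds z} → Walk es a ds z → All (λ dt → Incident (proj₁ dt) (List.lookup es (proj₂ dt))) ds
  walk-incident done = []
  walk-incident (step j w) = joins-incidentˡ j ∷ walk-incident w

  cycle⊆ : ∀ {A P es} → All (Ends∈ A) es → (c : DartCycle P es) → ∀ {u} → Visits u (darts c) → u ∈ A
  cycle⊆ {es = es} ends∈A c u∈ with find u∈
  ... | (u , p) , dt∈ , refl with All.lookup (walk-incident (DartCycle.walk c)) dt∈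
  ... | inj₁ refl = proj₁ (All.lookup ends∈A (∈-lookup p))
  ... | inj₂ refl = proj₂ (All.lookup ends∈A (∈-lookup p))

  rotate : ∀ {P es} {Q : Dart es → Set} (c : DartCycle P es) → Any Q (darts c) →
           Σ (DartCycle P es) (Q ∘ DartCycle.d)
  rotate c q with find q
  rotate c q | x , x∈ , qx with ∈-∃++ x∈
  rotate c q | x , x∈ , qx | [] , post , refl = c , qx
  rotate (dartCycle d ds w uV uE aP) q | x , x∈ , qx | (.d ∷ pre) , post , refl
    with walk-split (d ∷ pre) w
  ... | _ , w₁ , w₂@(step _ _) =
    dartCycle x (post ++ d ∷ pre) (walk-++ w₂ w₁)
      (unique-resp-↭ (PermP.map⁺ proj₁ rotation) uV)
      (unique-resp-↭ (PermP.map⁺ proj₂ rotation) uE)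
      (PermP.All-resp-↭ rotation aP) , qx
    where
    rotation : (d ∷ pre) ++ (x ∷ post) ↭ (x ∷ post) ++ (d ∷ pre)
    rotation = PermP.++-comm (d ∷ pre) (x ∷ post)

  record EdgeMap (es es′ : List (Edge n)) (Q : Pos es → Set) : Set where
    field
      pos           : (p : Pos es) → Q p → Pos es′
      lookup-pos    : ∀ p q → List.lookup es′ (pos p q) ≡ List.lookup es p
      pos-injective : ∀ p q p′ q′ → pos p q ≡ pos p′ q′ → p ≡ p′

  module MapDarts {es es′ Q} (m : EdgeMap es es′ Q) where
    open EdgeMap m

    Mappable : Dart es → Set
    Mappable dt = Q (proj₂ dt)

    mapDarts : (ds : List (Dart es)) → All Mappable ds → List (Dart es′)
    mapDarts [] [] = []
    mapDarts ((x , p) ∷ ds) (q ∷ qs) = (x , pos p q) ∷ mapDarts ds qs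

    mapDarts-vertices : ∀ {ds} (qs : All Mappable ds) → List.map proj₁ (mapDarts ds qs) ≡ List.map proj₁ ds
    mapDarts-vertices [] = refl
    mapDarts-vertices (_ ∷ qs) = cong (_ ∷_) (mapDarts-vertices qs)

    mapDarts-edges : ∀ {R : Pos es′ → Set} → (∀ p q → R (pos p q)) →
                     ∀ {ds} (qs : All Mappable ds) → All R (List.map proj₂ (mapDarts ds qs))
    mapDarts-edges h [] = []
    mapDarts-edges h (q ∷ qs) = h _ q ∷ mapDarts-edges h qs

    mapWalk : ∀ {a ds z} → Walk es a ds z → (qs : All Mappable ds) → Walk es′ a (mapDarts ds qs) z
    mapWalk done [] = done
    mapWalk (step j w) (q ∷ qs) = step (subst (λ e → Joins e _ _) (sym (lookup-pos _ q)) j) (mapWalk w qs)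

    mapDarts-uniqueV : ∀ {ds} (qs : All Mappable ds) → Unique (List.map proj₁ ds) →
                       Unique (List.map proj₁ (mapDarts ds qs))
    mapDarts-uniqueV qs = subst Unique (sym (mapDarts-vertices qs))

    mapDarts-uniqueE : ∀ {ds} (qs : All Mappable ds) → Unique (List.map proj₂ ds) →
                       Unique (List.map proj₂ (mapDarts ds qs))
    mapDarts-uniqueE [] [] = []
    mapDarts-uniqueE {(_ , p) ∷ ds} (q ∷ qs) (p≢ ∷ u) = ∷-unique (fresh p≢) (mapDarts-uniqueE qs u)
      where
      fresh : ∀ {ds} {qs : All Mappable ds} → All (p ≢_) (List.map proj₂ ds) →
              pos p q ∉ˡ List.map proj₂ (mapDarts ds qs)
      fresh {_ ∷ _} {_ ∷ _} (p≢p′ ∷ _) (here eq) = p≢p′ (pos-injective _ _ _ _ eq)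
      fresh {_ ∷ _} {_ ∷ _} (_ ∷ p≢) (there p∈) = fresh p≢ p∈

    mapDarts-allP : ∀ {P : Fin n → Set} {ds} (qs : All Mappable ds) → All (P ∘ proj₁) ds →
                    All (P ∘ proj₁) (mapDarts ds qs)
    mapDarts-allP [] [] = []
    mapDarts-allP (_ ∷ qs) (px ∷ ps) = px ∷ mapDarts-allP qs ps

    mapDartsCycle : ∀ {P} (c : DartCycle P es) → All Mappable (darts c) → DartCycle P es′
    mapDartsCycle (dartCycle d ds w uV uE aP) (q ∷ qs) =
      dartCycle (proj₁ d , pos (proj₂ d) q) (mapDarts ds qs) (mapWalk w (q ∷ qs))
        (mapDarts-uniqueV {d ∷ ds} (q ∷ qs) uV) (mapDarts-uniqueE {d ∷ ds} (q ∷ qs) uE)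
        (mapDarts-allP {ds = d ∷ ds} (q ∷ qs) aP)

  -- a cycle whose vertices satisfy P only uses edges with both ends satisfying P
  transportCycle : ∀ {P es es′ Q} → EdgeMap es es′ Q →
                   (∀ p → (∀ u → Incident u (List.lookup es p) → P u) → Q p) →
                   DartCycle P es → DartCycle P es′
  transportCycle {es = es} m h c =
    MapDarts.mapDartsCycle m c (All.map (λ {dt} → h (proj₂ dt)) (cycle-edges c))

  record _↪_ (es es′ : List (Edge n)) : Set where
    field
      pos           : Pos es → Pos es′
      lookup-pos    : ∀ p → List.lookup es′ (pos p) ≡ List.lookup es p
      pos-injective : ∀ {p p′} → pos p ≡ pos p′ → p ≡ p′

  embedCycle : ∀ {P es es′} → es ↪ es′ → DartCycle P es → DartCycle P es′
  embedCycle m = transportCycle {Q = λ _ → ⊤} edgeMap (λ _ _ → tt)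
    where
    open _↪_ m
    edgeMap : EdgeMap _ _ _
    edgeMap = record { pos = λ p _ → pos p ; lookup-pos = λ p _ → lookup-pos p
                     ; pos-injective = λ _ _ _ _ → pos-injective }

  pullbackCycle : ∀ {P es es′} {Q : Edge n → Set} (m : es′ ↪ es) →
    (∀ p → Q (List.lookup es p) → ∃[ p′ ] _↪_.pos m p′ ≡ p) →
    (∀ e → (∀ u → Incident u e → P u) → Q e) → DartCycle P es → DartCycle P es′
  pullbackCycle {es = es} {es′} m onto h = transportCycle edgeMap (λ p → h (List.lookup es p))
    where
    open _↪_ m
    edgeMap : EdgeMap es es′ _
    edgeMap = record
      { pos = λ p q → proj₁ (onto p q)
      ; lookup-pos = λ p q → trans (sym (lookup-pos (proj₁ (onto p q)))) (cong (List.lookup es) (proj₂ (onto p q)))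
      ; pos-injective = λ p q p′ q′ eq → trans (sym (proj₂ (onto p q))) (trans (cong pos eq) (proj₂ (onto p′ q′))) }

  ↭⇒↪ : ∀ {es es′} → es ↭ es′ → es ↪ es′
  ↭⇒↪ {es} {es′} p = record
    { pos = Inverse.to π
    ; lookup-pos = λ i → sym (PermSetoidP.onIndices-lookup (≡.setoid (Edge n)) (↭⇒↭ₛ p) i)
    ; pos-injective = Injection.injective (↔⇒↣ π) }
    where
    π = PermSetoid.onIndices (↭⇒↭ₛ p)

  module _ {Q : Edge n → Set} (Q? : Decidable Q) where

    filter-pos : ∀ es → Pos (List.filter Q? es) → Pos es
    filter-pos (e ∷ es) p with Q? e
    filter-pos (e ∷ es) zero | yes _ = zero
    filter-pos (e ∷ es) (suc p) | yes _ = suc (filter-pos es p)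
    ... | no _ = suc (filter-pos es p)

    filter-lookup : ∀ es p → List.lookup es (filter-pos es p) ≡ List.lookup (List.filter Q? es) p
    filter-lookup (e ∷ es) p with Q? e
    filter-lookup (e ∷ es) zero | yes _ = refl
    filter-lookup (e ∷ es) (suc p) | yes _ = filter-lookup es p
    ... | no _ = filter-lookup es p

    filter-pos-injective : ∀ es {p p′} → filter-pos es p ≡ filter-pos es p′ → p ≡ p′
    filter-pos-injective (e ∷ es) {p} {p′} eq with Q? e
    filter-pos-injective (e ∷ es) {zero} {zero} eq | yes _ = refl
    filter-pos-injective (e ∷ es) {suc p} {suc p′} eq | yes _ =
      cong suc (filter-pos-injective es (FinP.suc-injective eq))
    ... | no _ = filter-pos-injective es (FinP.suc-injective eq)

    filter-↪ : ∀ es → List.filter Q? es ↪ es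
    filter-↪ es = record
      { pos = filter-pos es ; lookup-pos = filter-lookup es ; pos-injective = filter-pos-injective es }

    filterCycle⁻ : ∀ {P es} → DartCycle P (List.filter Q? es) → DartCycle P es
    filterCycle⁻ = embedCycle (filter-↪ _)

    filter-onto : ∀ es p → Q (List.lookup es p) → ∃[ p′ ] filter-pos es p′ ≡ p
    filter-onto (e ∷ es) p q with Q? e
    filter-onto (e ∷ es) zero q | yes _ = zero , refl
    filter-onto (e ∷ es) zero q | no ¬q = contradiction q ¬q
    filter-onto (e ∷ es) (suc p) q | yes _ = Product.map suc (cong suc) (filter-onto es p q)
    filter-onto (e ∷ es) (suc p) q | no _ = Product.map id (cong suc) (filter-onto es p q)

    filterCycle⁺ : ∀ {P es} → (∀ e → (∀ u → Incident u e → P u) → Q e) →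
                   DartCycle P es → DartCycle P (List.filter Q? es)
    filterCycle⁺ {es = es} = pullbackCycle (filter-↪ es) (filter-onto es)

  Outside : Subset n → Edge n → Set
  Outside R e = proj₁ e ∉ R × proj₂ e ∉ R

  outside? : ∀ R → Decidable (Outside R)
  outside? R (u , v) = ¬? (u ∈? R) ×-dec ¬? (v ∈? R)

  keepOutside-filter : ∀ R E → keepOutside R E ≡ List.filter (outside? R) E
  keepOutside-filter R [] = refl
  keepOutside-filter R ((u , v) ∷ E) with u ∈? R | v ∈? R
  ... | yes u∈R | _ rewrite VecP.[]=⇒lookup u∈R = keepOutside-filter R E
  ... | no u∉R | yes v∈R rewrite ∉⇒lookup≡false u∉R | VecP.[]=⇒lookup v∈R = keepOutside-filter R E
  ... | no u∉R | no v∉R rewrite ∉⇒lookup≡false u∉R | ∉⇒lookup≡false v∉R =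
    cong (_ ∷_) (keepOutside-filter R E)

  incident? : ∀ (v : Fin n) → Decidable (Incident v)
  incident? v (a , b) = (a Fin.≟ v) ⊎-dec (b Fin.≟ v)

  dropIncident-filter : ∀ v es → dropIncident v es ≡ List.filter (¬? ∘ incident? v) es
  dropIncident-filter v [] = refl
  dropIncident-filter v ((a , b) ∷ es) with a Fin.≟ v | b Fin.≟ v
  ... | yes _ | _ = dropIncident-filter v es
  ... | no _ | yes _ = dropIncident-filter v es
  ... | no _ | no _ = cong (_ ∷_) (dropIncident-filter v es)

  endsAt : Fin n → Edge n → ℕ
  endsAt v (a , b) = δ a v + δ b v

  deg-∷ : ∀ v a b (es : List (Edge n)) → deg v ((a , b) ∷ es) ≡ endsAt v (a , b) + deg v es
  deg-∷ v a b es with a Fin.≟ v | b Fin.≟ v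
  ... | yes _ | yes _ = refl
  ... | yes _ | no _ = refl
  ... | no _ | yes _ = refl
  ... | no _ | no _ = refl

  incident⇒1≤endsAt : ∀ {v} {e : Edge n} → Incident v e → 1 ≤ endsAt v e
  incident⇒1≤endsAt {v} {.v , b} (inj₁ refl) rewrite δ-refl v = s≤s z≤n
  incident⇒1≤endsAt {v} {a , .v} (inj₂ refl) rewrite δ-refl v = ℕP.m≤n+m 1 (δ a v)

  ¬incident⇒endsAt≡0 : ∀ {v} {e : Edge n} → ¬ Incident v e → endsAt v e ≡ 0
  ¬incident⇒endsAt≡0 {v} {a , b} ¬i rewrite δ-≢ (¬i ∘ inj₁) | δ-≢ (¬i ∘ inj₂) = refl

  joins⇒endsAt≡1 : ∀ {e : Edge n} {x v} → Joins e x v → x ≢ v → endsAt v e ≡ 1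
  joins⇒endsAt≡1 {x = x} {v} (inj₁ refl) x≢v rewrite δ-≢ x≢v | δ-refl v = refl
  joins⇒endsAt≡1 {x = x} {v} (inj₂ refl) x≢v rewrite δ-≢ x≢v | δ-refl v = refl

  endsAt≤deg : ∀ v (es : List (Edge n)) p → endsAt v (List.lookup es p) ≤ deg v es
  endsAt≤deg v ((a , b) ∷ es) zero rewrite deg-∷ v a b es = ℕP.m≤m+n _ _
  endsAt≤deg v ((a , b) ∷ es) (suc p) rewrite deg-∷ v a b es =
    ℕP.≤-trans (endsAt≤deg v es p) (ℕP.m≤n+m _ _)

  endsAt+endsAt≤deg : ∀ v (es : List (Edge n)) {p q} → p ≢ q →
                      endsAt v (List.lookup es p) + endsAt v (List.lookup es q) ≤ deg v es
  endsAt+endsAt≤deg v ((a , b) ∷ es) {zero} {zero} p≢q = contradiction refl p≢q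
  endsAt+endsAt≤deg v ((a , b) ∷ es) {zero} {suc q} _ rewrite deg-∷ v a b es =
    ℕP.+-monoʳ-≤ (endsAt v (a , b)) (endsAt≤deg v es q)
  endsAt+endsAt≤deg v ((a , b) ∷ es) {suc p} {zero} _ rewrite deg-∷ v a b es
    | ℕP.+-comm (endsAt v (List.lookup es p)) (endsAt v (a , b)) =
    ℕP.+-monoʳ-≤ (endsAt v (a , b)) (endsAt≤deg v es p)
  endsAt+endsAt≤deg v ((a , b) ∷ es) {suc p} {suc q} p≢q rewrite deg-∷ v a b es =
    ℕP.≤-trans (endsAt+endsAt≤deg v es (p≢q ∘ cong suc)) (ℕP.m≤n+m _ _)

  -- the cycle enters and leaves v along two different edges, or is a loop at v
  cycle⇒2≤deg : ∀ {P es} (c : DartCycle P es) {v} → Visits v (darts c) → 2 ≤ deg v es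
  cycle⇒2≤deg {es = es} c {v} v∈ with rotate c v∈
  ... | dartCycle (.v , p₀) [] (step j done) _ _ _ , refl =
    subst (_≤ deg v es) (trans (cong (endsAt v) (joins-loop j)) loop≡2) (endsAt≤deg v es p₀)
    where
    loop≡2 : endsAt v (v , v) ≡ 2
    loop≡2 rewrite δ-refl v = refl
  ... | dartCycle (.v , p₀) (d₁ ∷ ds) (step {y = y} j w) _ (p₀∉ ∷ _) _ , refl with snocView d₁ ds
  ... | ini , (x , p) , eq =
    ℕP.≤-trans (ℕP.+-mono-≤ (incident⇒1≤endsAt (joins-incidentˡ j)) (incident⇒1≤endsAt (joins-incidentʳ jₗ)))
               (endsAt+endsAt≤deg v es p₀≢p)
    where
    jₗ : Joins (List.lookup es p) x v
    jₗ = walk-lastStep ini (subst (λ l → Walk es y l v) eq w)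
    p₀≢p : p₀ ≢ p
    p₀≢p = All.lookup p₀∉ (∈-map⁺ proj₂ (subst ((x , p) ∈ˡ_) (sym eq) (∈-++⁺ʳ ini (here refl))))

-- Cycles under the reduction rules

  keepOutsideCycle⁻ : ∀ {P R E} → DartCycle P (keepOutside R E) → DartCycle P E
  keepOutsideCycle⁻ {R = R} {E} = filterCycle⁻ (outside? R) ∘ subst (DartCycle _) (keepOutside-filter R E)

  keepOutsideCycle⁺ : ∀ {P R E} → (∀ {u} → P u → u ∉ R) → DartCycle P E → DartCycle P (keepOutside R E)
  keepOutsideCycle⁺ {R = R} {E} P⇒∉R =
    subst (DartCycle _) (sym (keepOutside-filter R E)) ∘
    filterCycle⁺ (outside? R) (λ e ends → P⇒∉R (ends _ (inj₁ refl)) , P⇒∉R (ends _ (inj₂ refl)))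

  dropIncidentCycle⁻ : ∀ {P v es} → DartCycle P (dropIncident v es) → DartCycle P es
  dropIncidentCycle⁻ {v = v} {es} =
    filterCycle⁻ (¬? ∘ incident? v) ∘ subst (DartCycle _) (dropIncident-filter v es)

  dropIncidentCycle⁺ : ∀ {P v es} → DartCycle (λ u → P u × u ≢ v) es → DartCycle P (dropIncident v es)
  dropIncidentCycle⁺ {v = v} {es} =
    subst (DartCycle _) (sym (dropIncident-filter v es)) ∘ mapCycle proj₁ ∘
    filterCycle⁺ (¬? ∘ incident? v) (λ e ends v∈e → proj₂ (ends v v∈e) refl)

  avoidsLowDegree : ∀ {P v es} → deg v es ≤ 1 → DartCycle P es → DartCycle (λ u → P u × u ≢ v) es
  avoidsLowDegree deg≤1 c =
    restrictCycle c (λ {u} u∈ u≡v → ℕP.<⇒≱ (s≤s deg≤1) (cycle⇒2≤deg c (subst (λ z → Visits z _) u≡v u∈)))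

  closedWalk⇒cycle : ∀ {P es x ds} → Walk es x ds x → Unique (List.map proj₁ ds) →
                     Unique (List.map proj₂ ds) → All (P ∘ proj₁) ds → ds ≢ [] → DartCycle P es
  closedWalk⇒cycle done _ _ _ ds≢[] = contradiction refl ds≢[]
  closedWalk⇒cycle w@(step _ _) uV uE aP _ = dartCycle _ _ w uV uE aP

  -- rule (2) replaces the path a – v – b by the edge (a , b), placed at position zero
  module Rule2 {es rest : List (Edge n)} {e₁ e₂ : Edge n} (v a b : Fin n)
    (perm : es ↭ e₁ ∷ e₂ ∷ rest) (j₁ : Joins e₁ v a) (j₂ : Joins e₂ v b)
    (a≢v : a ≢ v) (b≢v : b ≢ v) (rest∌v : All (λ e → ¬ Incident v e) rest) where

    es₂ es′ : List (Edge n)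
    es₂ = e₁ ∷ e₂ ∷ rest
    es′ = (a , b) ∷ rest

    Spoke : Pos es₂ → Set
    Spoke p = ∀ q → p ≢ suc (suc q)

    restPos : (p : Pos es′) → zero ≢ p → Pos es₂
    restPos zero 0≢0 = contradiction refl 0≢0
    restPos (suc p) _ = suc (suc p)

    restMap : EdgeMap es′ es₂ (zero ≢_)
    restMap = record { pos = restPos ; lookup-pos = lookup-pos ; pos-injective = pos-injective }
      where
      lookup-pos : ∀ p q → List.lookup es₂ (restPos p q) ≡ List.lookup es′ p
      lookup-pos zero 0≢0 = contradiction refl 0≢0
      lookup-pos (suc p) _ = refl
      pos-injective : ∀ p q p′ q′ → restPos p q ≡ restPos p′ q′ → p ≡ p′
      pos-injective zero 0≢0 _ _ _ = contradiction refl 0≢0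
      pos-injective (suc p) _ zero 0≢0 _ = contradiction refl 0≢0
      pos-injective (suc p) _ (suc p′) _ eq = cong suc (FinP.suc-injective (FinP.suc-injective eq))

    spoke≢restPos : ∀ {s} → Spoke s → ∀ p q → s ≢ restPos p q
    spoke≢restPos _ zero 0≢0 = contradiction refl 0≢0
    spoke≢restPos s-spoke (suc p) _ = s-spoke p

    toEs : ∀ {P} → DartCycle P es₂ → DartCycle P es
    toEs = embedCycle (↭⇒↪ (↭-sym perm))

    avoidingNewEdge : ∀ {P} (c : DartCycle P es′) → All ((zero ≢_) ∘ proj₂) (darts c) → DartCycle P es
    avoidingNewEdge c qs = toEs (MapDarts.mapDartsCycle restMap c qs)

    record Detour (x y : Fin n) : Set where
      field
        inP outP  : Pos es₂
        inP≢outP  : inP ≢ outP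
        inP-spoke : Spoke inP
        outP-spoke : Spoke outP
        x≢v       : x ≢ v
        joins-in  : Joins (List.lookup es₂ inP) x v
        joins-out : Joins (List.lookup es₂ outP) v y

    detour : ∀ {x y} → Joins (a , b) x y → Detour x y
    detour (inj₁ refl) = record
      { inP = zero ; outP = suc zero ; inP≢outP = λ () ; inP-spoke = λ _ () ; outP-spoke = λ _ ()
      ; x≢v = a≢v ; joins-in = joins-sym j₁ ; joins-out = j₂ }
    detour (inj₂ refl) = record
      { inP = suc zero ; outP = zero ; inP≢outP = λ () ; inP-spoke = λ _ () ; outP-spoke = λ _ ()
      ; x≢v = b≢v ; joins-in = joins-sym j₂ ; joins-out = j₁ }

    throughNewEdge : ∀ {P} → (∀ {u} → P u → u ≢ v) → (c : DartCycle P es′) → proj₂ (DartCycle.d c) ≡ zero →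
                     DartCycle (λ u → P u ⊎ u ≡ v) es
    throughNewEdge P∌v (dartCycle (x , .zero) ds (step {y = y} j w) (x∉ ∷ uV) (0∉ ∷ uE) (px ∷ aP)) refl =
      toEs (dartCycle (x , inP) ((v , outP) ∷ ds′) (step joins-in (step joins-out (mapWalk w qs)))
        ((x≢v ∷ subst (All (x ≢_)) (sym (mapDarts-vertices qs)) x∉) ∷
         subst (All (v ≢_)) (sym (mapDarts-vertices qs)) (AllP.map⁺ (All.map (λ pu v≡u → P∌v pu (sym v≡u)) aP)) ∷
         mapDarts-uniqueV qs uV)
        ((inP≢outP ∷ mapDarts-edges (spoke≢restPos inP-spoke) qs) ∷
         mapDarts-edges (spoke≢restPos outP-spoke) qs ∷
         mapDarts-uniqueE qs uE)
        (inj₁ px ∷ inj₂ refl ∷ mapDarts-allP qs (All.map inj₁ aP)))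
      where
      open Detour (detour j)
      open MapDarts restMap
      qs : All Mappable ds
      qs = AllP.map⁻ 0∉
      ds′ : List (Dart es₂)
      ds′ = mapDarts ds qs

    usesNewEdge? : ∀ {P} (c : DartCycle P es′) → Dec (Any ((_≡ zero) ∘ proj₂) (darts c))
    usesNewEdge? c = Any.any? (λ dt → proj₂ dt Fin.≟ zero) (darts c)

    avoids : ∀ {P} (c : DartCycle P es′) → ¬ Any ((_≡ zero) ∘ proj₂) (darts c) → All ((zero ≢_) ∘ proj₂) (darts c)
    avoids c ¬uses = All.map (λ ¬≡0 0≡p → ¬≡0 (sym 0≡p)) (AllP.¬Any⇒All¬ _ ¬uses)

    cycle⁻ : ∀ {P} → (∀ {u} → P u → u ≢ v) → DartCycle P es′ → DartCycle (λ u → P u ⊎ u ≡ v) es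
    cycle⁻ P∌v c with usesNewEdge? c
    ... | yes uses = let c′ , first≡0 = rotate c uses in throughNewEdge P∌v c′ first≡0
    ... | no ¬uses = mapCycle inj₁ (avoidingNewEdge c (avoids c ¬uses))

    -- a cycle missing the end a of the new edge cannot use it
    cycle⁻-∌a : ∀ {P} → ¬ P a → DartCycle P es′ → DartCycle P es
    cycle⁻-∌a ¬Pa c with usesNewEdge? c
    ... | no ¬uses = avoidingNewEdge c (avoids c ¬uses)
    ... | yes uses with find uses
    ... | (_ , .zero) , dt∈ , refl =
      contradiction (visits-P c (All.lookup (cycle-endpoints c) dt∈ a (inj₁ refl))) ¬Pa

    fromEs : ∀ {P} → DartCycle P es → DartCycle P es₂
    fromEs = embedCycle (↭⇒↪ perm)

    rest∌v′ : ∀ p → ¬ Incident v (List.lookup es₂ (suc (suc p)))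
    rest∌v′ p = All.lookup rest∌v (∈-lookup p)

    awayPos : (p : Pos es₂) → ¬ Incident v (List.lookup es₂ p) → Pos es′
    awayPos zero ¬i = contradiction (joins-incidentˡ j₁) ¬i
    awayPos (suc zero) ¬i = contradiction (joins-incidentˡ j₂) ¬i
    awayPos (suc (suc p)) _ = suc p

    zero≢awayPos : ∀ p q → zero ≢ awayPos p q
    zero≢awayPos zero ¬i = contradiction (joins-incidentˡ j₁) ¬i
    zero≢awayPos (suc zero) ¬i = contradiction (joins-incidentˡ j₂) ¬i
    zero≢awayPos (suc (suc p)) _ ()

    awayMap : EdgeMap es₂ es′ (λ p → ¬ Incident v (List.lookup es₂ p))
    awayMap = record { pos = awayPos ; lookup-pos = lookup-pos ; pos-injective = pos-injective }
      where
      lookup-pos : ∀ p q → List.lookup es′ (awayPos p q) ≡ List.lookup es₂ p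
      lookup-pos zero ¬i = contradiction (joins-incidentˡ j₁) ¬i
      lookup-pos (suc zero) ¬i = contradiction (joins-incidentˡ j₂) ¬i
      lookup-pos (suc (suc p)) _ = refl
      pos-injective : ∀ p q p′ q′ → awayPos p q ≡ awayPos p′ q′ → p ≡ p′
      pos-injective zero ¬i _ _ _ = contradiction (joins-incidentˡ j₁) ¬i
      pos-injective (suc zero) ¬i _ _ _ = contradiction (joins-incidentˡ j₂) ¬i
      pos-injective (suc (suc p)) _ zero ¬i _ = contradiction (joins-incidentˡ j₁) ¬i
      pos-injective (suc (suc p)) _ (suc zero) ¬i _ = contradiction (joins-incidentˡ j₂) ¬i
      pos-injective (suc (suc p)) _ (suc (suc p′)) _ eq = cong (λ p → suc (suc p)) (FinP.suc-injective eq)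

    avoidingV : ∀ {P} → DartCycle (λ u → P u × u ≢ v) es₂ → DartCycle P es′
    avoidingV = mapCycle proj₁ ∘ transportCycle awayMap (λ p ends v∈e → proj₂ (ends v v∈e) refl)

    -- the only edges at v are e₁ (to a) and e₂ (to b)
    bypass : ∀ {p₀ pₗ y x} → p₀ ≢ pₗ → Joins (List.lookup es₂ p₀) v y → Joins (List.lookup es₂ pₗ) x v →
             Joins (a , b) x y
    bypass {zero} {zero} p₀≢pₗ _ _ = contradiction refl p₀≢pₗ
    bypass {zero} {suc zero} _ j jₗ
      rewrite joins-unique a≢v j j₁ | joins-unique b≢v (joins-sym jₗ) j₂ = inj₂ refl
    bypass {suc zero} {zero} _ j jₗ
      rewrite joins-unique b≢v j j₂ | joins-unique a≢v (joins-sym jₗ) j₁ = inj₁ refl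
    bypass {suc zero} {suc zero} p₀≢pₗ _ _ = contradiction refl p₀≢pₗ
    bypass {suc (suc p)} _ j _ = contradiction (joins-incidentˡ j) (rest∌v′ p)
    bypass {zero} {suc (suc p)} _ _ jₗ = contradiction (joins-incidentʳ jₗ) (rest∌v′ p)
    bypass {suc zero} {suc (suc p)} _ _ jₗ = contradiction (joins-incidentʳ jₗ) (rest∌v′ p)

    no-loop : ∀ p → List.lookup es₂ p ≢ (v , v)
    no-loop zero eq = a≢v (sym (joins-unique a≢v (subst (λ e → Joins e v v) (sym eq) (inj₁ refl)) j₁))
    no-loop (suc zero) eq = b≢v (sym (joins-unique b≢v (subst (λ e → Joins e v v) (sym eq) (inj₁ refl)) j₂))
    no-loop (suc (suc p)) eq = rest∌v′ p (subst (Incident v) (sym eq) (inj₁ refl))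

    throughV : ∀ {P} (c : DartCycle P es₂) → v ≡ proj₁ (DartCycle.d c) → DartCycle P es′
    throughV (dartCycle (.v , p₀) [] (step j done) _ _ _) refl = contradiction (joins-loop j) (no-loop p₀)
    throughV {P} (dartCycle (.v , p₀) (d₁ ∷ ds) (step {y = y} j w) (v∉ ∷ uV) (p₀∉ ∷ uE) (_ ∷ aP)) refl
      with snocView d₁ ds
    ... | ini , (x , pₗ) , eq with walk-split ini (subst (λ l → Walk es₂ y l v) eq w)
    ... | _ , w₁ , step jₗ done =
      closedWalk⇒cycle (walk-++ (mapWalk w₁ qs) (step (bypass p₀≢pₗ j jₗ) done))
        (subst Unique (sym vertices≡) (subst (Unique ∘ List.map proj₁) eq uV))
        (subst Unique (sym (ListP.map-++ proj₂ (mapDarts ini qs) _))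
          (∷ʳ-unique (AllP.All¬⇒¬Any (mapDarts-edges zero≢awayPos qs))
            (mapDarts-uniqueE qs (unique-++⁻ˡ (List.map proj₂ ini)
              (subst Unique (ListP.map-++ proj₂ ini _) (subst (Unique ∘ List.map proj₂) eq uE))))))
        (AllP.++⁺ (mapDarts-allP qs (AllP.++⁻ˡ ini aPₗ)) (All.head (AllP.++⁻ʳ ini aPₗ) ∷ []))
        (λ eq′ → case ListP.++-conicalʳ (mapDarts ini qs) _ eq′ of λ ())
      where
      open MapDarts awayMap
      darts≢v : All (λ dt → v ≢ proj₁ dt) (ini ∷ʳ (x , pₗ))
      darts≢v = subst (All (λ dt → v ≢ proj₁ dt)) eq (AllP.map⁻ v∉)
      p₀≢pₗ : p₀ ≢ pₗ
      p₀≢pₗ = All.lookup p₀∉ (∈-map⁺ proj₂ (subst ((x , pₗ) ∈ˡ_) (sym eq) (∈-++⁺ʳ ini (here refl))))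
      qs : All Mappable ini
      qs = All.map (λ ends v∈e → Sum.[ AllP.All¬⇒¬Any (AllP.++⁻ˡ ini darts≢v) , All.head (AllP.++⁻ʳ ini darts≢v) ]
                                        (ends v v∈e))
                   (walk-endpoints w₁)
      aPₗ : All (P ∘ proj₁) (ini ∷ʳ (x , pₗ))
      aPₗ = subst (All (P ∘ proj₁)) eq aP
      vertices≡ : List.map proj₁ (mapDarts ini qs ∷ʳ (x , zero)) ≡ List.map proj₁ (ini ∷ʳ (x , pₗ))
      vertices≡ = begin
        List.map proj₁ (mapDarts ini qs ∷ʳ (x , zero))     ≡⟨ ListP.map-++ proj₁ (mapDarts ini qs) _ ⟩
        List.map proj₁ (mapDarts ini qs) ∷ʳ x              ≡⟨ cong (_∷ʳ x) (mapDarts-vertices qs) ⟩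
        List.map proj₁ ini ∷ʳ x                            ≡⟨ ListP.map-++ proj₁ ini _ ⟨
        List.map proj₁ (ini ∷ʳ (x , pₗ))                   ∎
        where open ≡.≡-Reasoning

    cycle⁺ : ∀ {P} → DartCycle P es → DartCycle P es′
    cycle⁺ c with Any.any? (λ dt → v Fin.≟ proj₁ dt) (darts (fromEs c))
    ... | yes v∈ = let c′ , v≡first = rotate (fromEs c) v∈ in throughV c′ v≡first
    ... | no v∉ = avoidingV (restrictCycle (fromEs c) (λ {u} u∈ u≡v → v∉ (subst (λ z → Visits z _) u≡v u∈)))

-- Acyclic vertex sets span few edges

  within : Subset n → Edge n → ℕ
  within B (a , b) = bit (Vec.lookup B a ∧ Vec.lookup B b)

  edgesWithin : Subset n → List (Edge n) → ℕ
  edgesWithin B es = sum (λ p → within B (List.lookup es p))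

  innerDeg : Subset n → Fin n → List (Edge n) → ℕ
  innerDeg B v es = sum (λ p → within B (List.lookup es p) * endsAt v (List.lookup es p))

  within≡1⇒ends∈ : ∀ {B} {e : Edge n} → within B e ≡ 1 → Ends∈ B e
  within≡1⇒ends∈ {B} {a , b} eq with Vec.lookup B a in ea | Vec.lookup B b in eb | eq
  ... | true | true | _ = VecP.lookup⇒[]= a B ea , VecP.lookup⇒[]= b B eb
  ... | true | false | ()
  ... | false | _ | ()

  InnerEdgeAt : Subset n → Fin n → Edge n → Set
  InnerEdgeAt B c e = within B e ≡ 1 × Incident c e

  innerEdgeAt? : ∀ B c → Decidable (InnerEdgeAt B c)
  innerEdgeAt? B c e = (within B e ℕ.≟ 1) ×-dec incident? c e

  ¬innerEdgeAt⇒term≡0 : ∀ B {c} {e : Edge n} → ¬ InnerEdgeAt B c e → within B e * endsAt c e ≡ 0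
  ¬innerEdgeAt⇒term≡0 B {c} {a , b} ¬inner with Vec.lookup B a ∧ Vec.lookup B b
  ... | false = refl
  ... | true = trans (ℕP.*-identityˡ _) (¬incident⇒endsAt≡0 (λ i → ¬inner (refl , i)))

  other-end : ∀ {e : Edge n} {c} → Incident c e → ∃[ w ] Joins e c w
  other-end {a , b} (inj₁ refl) = b , inj₁ refl
  other-end {a , b} (inj₂ refl) = a , inj₂ refl

  lastEdge-only : ∀ {es x ds cur q} → Walk es x ds cur → Unique (List.map proj₁ ds ∷ʳ cur) →
                  q ∈ˡ List.map proj₂ ds → Incident cur (List.lookup es q) →
                  ∃[ ini ] ∃[ x′ ] ds ≡ ini ∷ʳ (x′ , q)
  lastEdge-only (step {x = x} j done) _ (here refl) _ = [] , x , refl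
  lastEdge-only (step {ds = ds} j w@(step _ _)) (x≢ ∷ u) (here refl) cur∈e with joins-incident j cur∈e
  ... | inj₁ refl = contradiction refl (All.lookup x≢ (∈-++⁺ʳ (List.map proj₁ ds) (here refl)))
  ... | inj₂ refl = contradiction (here refl) (unique-++-disjoint (List.map proj₁ ds) u (here refl))
  lastEdge-only (step {x = x} j w) (_ ∷ u) (there q∈) cur∈e with lastEdge-only w u q∈ cur∈e
  ... | ini , x′ , refl = (x , _) ∷ ini , x′ , refl

  module FindCycle {es : List (Edge n)} (B : Subset n)
    (2≤innerDeg : ∀ {v} → v ∈ B → 2 ≤ innerDeg B v es) where

    record Path : Set where
      constructor path
      field
        start   : Fin n
        ds      : List (Dart es)
        cur     : Fin n
        walk    : Walk es start ds cur
        uniqueV : Unique (List.map proj₁ ds ∷ʳ cur)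
        uniqueE : Unique (List.map proj₂ ds)
        allB    : All ((_∈ B) ∘ proj₁) ds
        cur∈B   : cur ∈ B

    innerDeg≡0 : ∀ {c} → (∀ q → ¬ InnerEdgeAt B c (List.lookup es q)) → innerDeg B c es ≡ 0
    innerDeg≡0 none = trans (sum-cong-≗ (λ q → ¬innerEdgeAt⇒term≡0 B (none q))) (sum-zero (length es))

    innerDeg≤1 : ∀ {c} pₗ → (∀ q → InnerEdgeAt B c (List.lookup es q) → q ≡ pₗ) →
                 endsAt c (List.lookup es pₗ) ≡ 1 → innerDeg B c es ≤ 1
    innerDeg≤1 {c} pₗ onlyₗ ends≡1 = ℕP.≤-trans (sum-mono-≤ term≤δ) (ℕP.≤-reflexive (sum-δ pₗ))
      where
      term≤δ : ∀ q → within B (List.lookup es q) * endsAt c (List.lookup es q) ≤ δ pₗ q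
      term≤δ q with innerEdgeAt? B c (List.lookup es q)
      ... | no ¬inner = ℕP.≤-trans (ℕP.≤-reflexive (¬innerEdgeAt⇒term≡0 B ¬inner)) z≤n
      ... | yes inner@(within≡1 , _) with onlyₗ q inner
      ... | refl rewrite within≡1 | ends≡1 | δ-refl pₗ = ℕP.≤-refl

    pathInnerDeg≤1 : ∀ {x₀ cur} ds → Walk es x₀ ds cur → Unique (List.map proj₁ ds ∷ʳ cur) →
                     (∀ q → InnerEdgeAt B cur (List.lookup es q) → q ∈ˡ List.map proj₂ ds) →
                     innerDeg B cur es ≤ 1
    pathInnerDeg≤1 [] _ _ used = ℕP.≤-trans (ℕP.≤-reflexive (innerDeg≡0 (λ q inner → case used q inner of λ ()))) z≤n
    pathInnerDeg≤1 {x₀} {cur} (d ∷ ds) w uV used with snocView d ds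
    ... | ini , (xₗ , pₗ) , eq = innerDeg≤1 pₗ onlyₗ (joins⇒endsAt≡1 (walk-lastStep ini w′) xₗ≢cur)
      where
      w′ : Walk es x₀ (ini ∷ʳ (xₗ , pₗ)) cur
      w′ = subst (λ l → Walk es x₀ l cur) eq w
      uV′ : Unique (List.map proj₁ (ini ∷ʳ (xₗ , pₗ)) ∷ʳ cur)
      uV′ = subst (λ l → Unique (List.map proj₁ l ∷ʳ cur)) eq uV
      xₗ≢cur : xₗ ≢ cur
      xₗ≢cur xₗ≡cur = unique-++-disjoint (List.map proj₁ (ini ∷ʳ (xₗ , pₗ))) uV′
                        (∈-map⁺ proj₁ (∈-++⁺ʳ ini (here refl))) (here xₗ≡cur)
      onlyₗ : ∀ q → InnerEdgeAt B cur (List.lookup es q) → q ≡ pₗ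
      onlyₗ q inner with lastEdge-only w′ uV′ (subst (λ l → q ∈ˡ List.map proj₂ l) eq (used q inner)) (proj₂ inner)
      ... | ini′ , _ , eq′ = sym (cong proj₂ (ListP.∷ʳ-injectiveʳ ini ini′ eq′))

    freshEdge : (π : Path) → let open Path π in
                ∃[ q ] InnerEdgeAt B cur (List.lookup es q) × q ∉ˡ List.map proj₂ ds
    freshEdge (path x₀ ds cur w uV uE aB cur∈B)
      with FinP.any? (λ q → innerEdgeAt? B cur (List.lookup es q) ×-dec ¬? (Any.any? (q Fin.≟_) (List.map proj₂ ds)))
    ... | yes found = found
    ... | no none = contradiction (2≤innerDeg cur∈B) (ℕP.<⇒≱ (s≤s (pathInnerDeg≤1 ds w uV used)))
      where
      used : ∀ q → InnerEdgeAt B cur (List.lookup es q) → q ∈ˡ List.map proj₂ ds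
      used q inner with Any.any? (q Fin.≟_) (List.map proj₂ ds)
      ... | yes q∈ = q∈
      ... | no q∉ = contradiction (q , inner , q∉) none

    extend : (π : Path) → let open Path π in ∀ {q y} → InnerEdgeAt B cur (List.lookup es q) →
             Joins (List.lookup es q) cur y → q ∉ˡ List.map proj₂ ds → y ∉ˡ List.map proj₁ ds ∷ʳ cur → Path
    extend (path x₀ ds cur w uV uE aB cur∈B) {q} {y} (within≡1 , _) jq q∉ y∉ =
      path x₀ (ds ∷ʳ (cur , q)) y (walk-++ w (step jq done))
        (subst (Unique ∘ (_∷ʳ y)) (sym (ListP.map-++ proj₁ ds _)) (∷ʳ-unique y∉ uV))
        (subst Unique (sym (ListP.map-++ proj₂ ds _)) (∷ʳ-unique q∉ uE))
        (AllP.∷ʳ⁺ aB cur∈B)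
        (joins⇒∈ʳ (within≡1⇒ends∈ within≡1) jq)

    closeAt : (π : Path) → let open Path π in ∀ {q y} → Joins (List.lookup es q) cur y →
              q ∉ˡ List.map proj₂ ds → Visits y ds → DartCycle (_∈ B) es
    closeAt (path x₀ ds cur w uV uE aB cur∈B) {q} jq q∉ y∈ with find y∈
    ... | (y , p) , dt∈ , refl with ∈-∃++ dt∈
    ... | pre , post , refl with walk-split pre w
    ... | _ , _ , step j w₃ =
      dartCycle (y , p) (post ∷ʳ (cur , q)) (step j (walk-++ w₃ (step jq done)))
        (subst Unique (sym (ListP.map-++ proj₁ cyc _)) uV′)
        (subst Unique (sym (ListP.map-++ proj₂ cyc _)) (∷ʳ-unique (q∉ ∘ ∈-cyc) uE′))
        (AllP.∷ʳ⁺ (AllP.++⁻ʳ pre aB) cur∈B)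
      where
      cyc : List (Dart es)
      cyc = (y , p) ∷ post
      vertices≡ : List.map proj₁ (pre ++ cyc) ∷ʳ cur ≡ List.map proj₁ pre ++ (List.map proj₁ cyc ∷ʳ cur)
      vertices≡ = trans (cong (_∷ʳ cur) (ListP.map-++ proj₁ pre cyc)) (ListP.++-assoc (List.map proj₁ pre) _ _)
      uV′ : Unique (List.map proj₁ cyc ∷ʳ cur)
      uV′ = unique-++⁻ʳ (List.map proj₁ pre) (subst Unique vertices≡ uV)
      uE′ : Unique (List.map proj₂ cyc)
      uE′ = unique-++⁻ʳ (List.map proj₂ pre) (subst Unique (ListP.map-++ proj₂ pre cyc) uE)
      ∈-cyc : q ∈ˡ List.map proj₂ cyc → q ∈ˡ List.map proj₂ (pre ++ cyc)
      ∈-cyc q∈ = subst (q ∈ˡ_) (sym (ListP.map-++ proj₂ pre cyc)) (∈-++⁺ʳ (List.map proj₂ pre) q∈)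

    search : ∀ fuel (π : Path) → length (Path.ds π) + fuel ≡ n → DartCycle (_∈ B) es
    search zero (path _ ds cur _ uV _ _ _) len≡n = contradiction (unique-length≤ _ uV) (ℕP.<⇒≱ longer)
      where
      longer : n < length (List.map proj₁ ds ∷ʳ cur)
      longer = begin-strict
        n                                   ≡⟨ trans (sym len≡n) (ℕP.+-identityʳ (length ds)) ⟩
        length ds                           ≡⟨ ListP.length-map proj₁ ds ⟨
        length (List.map proj₁ ds)          <⟨ ℕP.m<m+n _ (s≤s z≤n) ⟩
        length (List.map proj₁ ds) + 1      ≡⟨ ListP.length-++ (List.map proj₁ ds) ⟨
        length (List.map proj₁ ds ∷ʳ cur)   ∎
        where open ℕP.≤-Reasoning
    search (suc fuel) π@(path x₀ ds cur w uV uE aB cur∈B) len≡n with freshEdge π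
    ... | q , inner , q∉ with other-end (proj₂ inner)
    ... | y , jq with y Fin.≟ cur
    ... | yes refl = dartCycle (y , q) [] (step jq done) (∷-unique (λ ()) []) (∷-unique (λ ()) []) (cur∈B ∷ [])
    ... | no y≢cur with Any.any? (λ dt → y Fin.≟ proj₁ dt) ds
    ... | yes y∈ = closeAt π jq q∉ y∈
    ... | no y∉ = search fuel (extend π inner jq q∉ y∉′) (trans longer len≡n)
      where
      y∉′ : y ∉ˡ List.map proj₁ ds ∷ʳ cur
      y∉′ y∈ with ∈-++⁻ (List.map proj₁ ds) y∈
      ... | inj₁ y∈ds = y∉ (AnyP.map⁻ y∈ds)
      ... | inj₂ (here y≡cur) = y≢cur y≡cur
      longer : length (ds ∷ʳ (cur , q)) + fuel ≡ length ds + suc fuel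
      longer = trans (cong (_+ fuel) (ListP.length-++ ds)) (ℕP.+-assoc (length ds) 1 fuel)

    findCycle : ∀ {v₀} → v₀ ∈ B → DartCycle (_∈ B) es
    findCycle {v₀} v₀∈B = search n (path v₀ [] v₀ done ([] ∷ []) [] [] v₀∈B) refl

  within≤term : ∀ B {v} {e : Edge n} → Incident v e → within B e ≤ within B e * endsAt v e
  within≤term B {v} {e} v∈e = begin
    within B e                ≡⟨ ℕP.*-identityʳ (within B e) ⟨
    within B e * 1            ≤⟨ ℕP.*-monoʳ-≤ (within B e) (incident⇒1≤endsAt v∈e) ⟩
    within B e * endsAt v e   ∎
    where open ℕP.≤-Reasoning

  within-remove : ∀ B v (e : Edge n) → within B e ≤ within (B - v) e + within B e * endsAt v e
  within-remove B v (a , b) = cases (a Fin.≟ v) (b Fin.≟ v)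
    where
    cases : Dec (a ≡ v) → Dec (b ≡ v) → within B (a , b) ≤ within (B - v) (a , b) + within B (a , b) * endsAt v (a , b)
    cases (yes a≡v) _ = ℕP.≤-trans (within≤term B (inj₁ a≡v)) (ℕP.m≤n+m _ _)
    cases _ (yes b≡v) = ℕP.≤-trans (within≤term B (inj₂ b≡v)) (ℕP.m≤n+m _ _)
    cases (no a≢v) (no b≢v) = ℕP.≤-trans (ℕP.≤-reflexive unchanged) (ℕP.m≤m+n _ _)
      where
      unchanged : within B (a , b) ≡ within (B - v) (a , b)
      unchanged rewrite lookup-─ B ⁅ v ⁆ a | lookup-─ B ⁅ v ⁆ b
                      | ∉⇒lookup≡false (a≢v ∘ x∈⁅y⁆⇒x≡y v) | ∉⇒lookup≡false (b≢v ∘ x∈⁅y⁆⇒x≡y v)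
                      | BoolP.∧-identityʳ (Vec.lookup B a) | BoolP.∧-identityʳ (Vec.lookup B b) = refl

  edgesWithin-remove : ∀ B v es → edgesWithin B es ≤ edgesWithin (B - v) es + innerDeg B v es
  edgesWithin-remove B v es = begin
    edgesWithin B es                                         ≤⟨ sum-mono-≤ (λ p → within-remove B v (List.lookup es p)) ⟩
    sum (λ p → within (B - v) (List.lookup es p) + _)    ≡⟨ ∑-distrib-+ (λ p → within (B - v) (List.lookup es p)) _ ⟩
    edgesWithin (B - v) es + innerDeg B v es             ∎
    where open ℕP.≤-Reasoning

  edgesWithin-∅ : ∀ B (es : List (Edge n)) → (∀ v → v ∉ B) → edgesWithin B es ≡ 0
  edgesWithin-∅ B es empty = trans (sum-cong-≗ within≡0) (sum-zero (length es))
    where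
    within≡0 : ∀ p → within B (List.lookup es p) ≡ 0
    within≡0 p with List.lookup es p
    ... | a , b rewrite ∉⇒lookup≡false (empty a) = refl

  -- peel off vertices of inner degree ≤ 1; if there are none, FindCycle produces a cycle
  acyclic⇒edgesWithin≤ : ∀ k (B : Subset n) es → ∣ B ∣ ≡ k → ¬ DartCycle (_∈ B) es → edgesWithin B es ≤ ∣ B ∣
  acyclic⇒edgesWithin≤ k B es |B|≡k acyclic with FinP.any? (λ v → (v ∈? B) ×-dec (innerDeg B v es ℕ.≤? 1))
  ... | yes (v , v∈B , deg≤1) = begin
    edgesWithin B es                         ≤⟨ edgesWithin-remove B v es ⟩
    edgesWithin (B - v) es + innerDeg B v es ≤⟨ ℕP.+-mono-≤ (smaller k |B|≡k) deg≤1 ⟩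
    ∣ B - v ∣ + 1                            ≡⟨ ℕP.+-comm (∣ B - v ∣) 1 ⟩
    suc ∣ B - v ∣                            ≡⟨ ∣p∣≡1+∣p-x∣ v∈B ⟨
    ∣ B ∣                                    ∎
    where
    open ℕP.≤-Reasoning
    smaller : ∀ k → ∣ B ∣ ≡ k → edgesWithin (B - v) es ≤ ∣ B - v ∣
    smaller zero |B|≡0 = case trans (sym (∣p∣≡1+∣p-x∣ v∈B)) |B|≡0 of λ ()
    smaller (suc k) |B|≡1+k = acyclic⇒edgesWithin≤ k (B - v) es
      (ℕP.suc-injective (trans (sym (∣p∣≡1+∣p-x∣ v∈B)) |B|≡1+k)) (acyclic ∘ mapCycle (p─q⊆p B ⁅ v ⁆))
  ... | no none with FinP.any? (_∈? B)
  ... | yes (_ , v₀∈B) =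
    contradiction (FindCycle.findCycle B (λ {v} v∈B → ℕP.≰⇒> (λ deg≤1 → none (v , v∈B , deg≤1))) v₀∈B) acyclic
  ... | no empty = ℕP.≤-trans (ℕP.≤-reflexive (edgesWithin-∅ B es (λ v v∈B → empty (v , v∈B)))) z≤n

-- Vertices of degree at least three

  record IncidentSplit (v : Fin n) (es : List (Edge n)) : Set where
    field
      atV rest   : List (Edge n)
      perm       : es ↭ atV ++ rest
      atV-joins  : All (λ e → ∃[ a ] Joins e v a × a ≢ v) atV
      rest∌v     : All (λ e → ¬ Incident v e) rest
      length≡deg : length atV ≡ deg v es

  incidentSplit : ∀ v (es : List (Edge n)) → All (_≢ (v , v)) es → IncidentSplit v es
  incidentSplit v [] [] = record
    { atV = [] ; rest = [] ; perm = Perm.refl ; atV-joins = [] ; rest∌v = [] ; length≡deg = refl }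
  incidentSplit v ((x , y) ∷ es) (not-loop ∷ not-loops) = extend (x Fin.≟ v) (y Fin.≟ v)
    where
    open IncidentSplit (incidentSplit v es not-loops)
    extend : Dec (x ≡ v) → Dec (y ≡ v) → IncidentSplit v ((x , y) ∷ es)
    extend (yes refl) (yes refl) = contradiction refl not-loop
    extend (yes refl) (no y≢v) = record
      { atV = (v , y) ∷ atV ; rest = rest ; perm = Perm.prep _ perm
      ; atV-joins = (y , inj₁ refl , y≢v) ∷ atV-joins ; rest∌v = rest∌v
      ; length≡deg = trans (cong suc length≡deg)
          (sym (trans (deg-∷ v v y es) (cong (_+ deg v es) (joins⇒endsAt≡1 (inj₂ refl) y≢v)))) }
    extend (no x≢v) (yes refl) = record
      { atV = (x , v) ∷ atV ; rest = rest ; perm = Perm.prep _ perm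
      ; atV-joins = (x , inj₂ refl , x≢v) ∷ atV-joins ; rest∌v = rest∌v
      ; length≡deg = trans (cong suc length≡deg)
          (sym (trans (deg-∷ v x v es) (cong (_+ deg v es) (joins⇒endsAt≡1 (inj₁ refl) x≢v)))) }
    extend (no x≢v) (no y≢v) = record
      { atV = atV ; rest = (x , y) ∷ rest
      ; perm = Perm.trans (Perm.prep _ perm) (↭-sym (PermP.shift (x , y) atV rest))
      ; atV-joins = atV-joins ; rest∌v = ¬x∨y ∷ rest∌v
      ; length≡deg = trans length≡deg (sym (trans (deg-∷ v x y es) (cong (_+ deg v es) (¬incident⇒endsAt≡0 ¬x∨y)))) }
      where
      ¬x∨y : ¬ Incident v (x , y)
      ¬x∨y = Sum.[ x≢v , y≢v ]

  -- a vertex outside S of degree ≤ 2 and without loops could still be reduced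
  irreducible⇒3≤deg : ∀ {S A : Subset n} {es} → (∀ H′ → ¬ Step S (mg A es) H′) → ∀ {v} → v ∈ A → v ∉ S →
                      ¬ DartCycle (λ u → u ∈ A × u ∉ S) es → 3 ≤ deg v es
  irreducible⇒3≤deg {S} {A} {es} irreducible {v} v∈A v∉S acyclic with deg v es ℕ.≤? 1
  ... | yes deg≤1 = contradiction (rule1 v v∈A v∉S deg≤1) (irreducible _)
  ... | no deg≰1 with incidentSplit v es (All.tabulate no-loop)
    where
    no-loop : ∀ {e} → e ∈ˡ es → e ≢ (v , v)
    no-loop e∈ refl = acyclic (dartCycle (v , Any.index e∈) [] (step (inj₁ (sym (AnyP.lookup-index e∈))) done)
                                         (∷-unique (λ ()) []) (∷-unique (λ ()) []) ((v∈A , v∉S) ∷ []))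
  ... | record { atV = [] ; length≡deg = len } = contradiction (subst (_≤ 1) len z≤n) deg≰1
  ... | record { atV = _ ∷ [] ; length≡deg = len } = contradiction (subst (_≤ 1) len (s≤s z≤n)) deg≰1
  ... | record { atV = _ ∷ _ ∷ [] ; perm = perm
               ; atV-joins = (a , j₁ , a≢v) ∷ (b , j₂ , b≢v) ∷ [] ; rest∌v = rest∌v } =
    contradiction (rule2 v a b v∈A v∉S perm j₁ j₂ a≢v b≢v rest∌v) (irreducible _)
  ... | record { atV = _ ∷ _ ∷ _ ∷ _ ; length≡deg = len } = subst (3 ≤_) len (s≤s (s≤s (s≤s z≤n)))

  sum-*endsAt : ∀ (w : Fin n → ℕ) e → sum (λ v → w v * endsAt v e) ≡ w (proj₁ e) + w (proj₂ e)
  sum-*endsAt w (a , b) = begin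
    sum (λ v → w v * (δ a v + δ b v))             ≡⟨ sum-cong-≗ (λ v → ℕP.*-distribˡ-+ (w v) (δ a v) (δ b v)) ⟩
    sum (λ v → w v * δ a v + w v * δ b v)         ≡⟨ ∑-distrib-+ (λ v → w v * δ a v) (λ v → w v * δ b v) ⟩
    sum (λ v → w v * δ a v) + sum (λ v → w v * δ b v) ≡⟨ cong₂ _+_ (sum-*δ w a) (sum-*δ w b) ⟩
    w a + w b                                     ∎
    where open ≡.≡-Reasoning

  sum-*deg : ∀ (w : Fin n → ℕ) (es : List (Edge n)) →
             sum (λ v → w v * deg v es) ≡ sum (λ p → w (proj₁ (List.lookup es p)) + w (proj₂ (List.lookup es p)))
  sum-*deg w [] = trans (sum-cong-≗ (ℕP.*-zeroʳ ∘ w)) (sum-zero n)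
  sum-*deg w ((a , b) ∷ es) = begin
    sum (λ v → w v * deg v ((a , b) ∷ es))                   ≡⟨ sum-cong-≗ (λ v → cong (w v *_) (deg-∷ v a b es)) ⟩
    sum (λ v → w v * (endsAt v (a , b) + deg v es))           ≡⟨ sum-cong-≗ (λ v → ℕP.*-distribˡ-+ (w v) _ _) ⟩
    sum (λ v → w v * endsAt v (a , b) + w v * deg v es)       ≡⟨ ∑-distrib-+ (λ v → w v * endsAt v (a , b)) _ ⟩
    sum (λ v → w v * endsAt v (a , b)) + sum (λ v → w v * deg v es)
                                                              ≡⟨ cong₂ _+_ (sum-*endsAt w (a , b)) (sum-*deg w es) ⟩
    w a + w b + sum (λ p → w (proj₁ (List.lookup es p)) + w (proj₂ (List.lookup es p))) ∎
    where open ≡.≡-Reasoning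

  -- sx and wx record whether the end x of an edge inside A lies in S and in W
  endsInC≤ : ∀ sa wa sb wb → (wa ≡ true → sa ≡ false) → (wb ≡ true → sb ≡ false) →
    bit (not sa ∧ not wa) + bit (not sb ∧ not wb) ≤ bit (not wa ∧ not wb) + bit (not sa ∧ not sb)
  endsInC≤ true true _ _ disj _ = case disj refl of λ ()
  endsInC≤ _ _ true true _ disj = case disj refl of λ ()
  endsInC≤ false false false false _ _ = ℕP.≤-refl
  endsInC≤ false false false true _ _ = ℕP.≤-refl
  endsInC≤ false false true false _ _ = ℕP.≤-refl
  endsInC≤ false true false false _ _ = ℕP.≤-refl
  endsInC≤ false true false true _ _ = z≤n
  endsInC≤ false true true false _ _ = z≤n
  endsInC≤ true false false false _ _ = ℕP.≤-refl
  endsInC≤ true false false true _ _ = z≤n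
  endsInC≤ true false true false _ _ = z≤n

  ends∈C≤within : ∀ {A S W : Subset n} → (∀ {x} → x ∈ W → x ∉ S) → ∀ {e : Edge n} → Ends∈ A e →
    χ (A ─ S ─ W) (proj₁ e) + χ (A ─ S ─ W) (proj₂ e) ≤ within (A ─ W) e + within (A ─ S) e
  ends∈C≤within {A} {S} {W} W∩S=∅ {a , b} (a∈A , b∈A)
    rewrite lookup-─ (A ─ S) W a | lookup-─ (A ─ S) W b | lookup-─ A S a | lookup-─ A S b
          | lookup-─ A W a | lookup-─ A W b | VecP.[]=⇒lookup a∈A | VecP.[]=⇒lookup b∈A =
    endsInC≤ _ _ _ _ (disjoint a) (disjoint b)
    where
    disjoint : ∀ x → Vec.lookup W x ≡ true → Vec.lookup S x ≡ false
    disjoint x x∈W = ∉⇒lookup≡false (W∩S=∅ (VecP.lookup⇒[]= x W x∈W))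

  three∣C∣≤edges : ∀ {A S W : Subset n} (es : List (Edge n)) → All (Ends∈ A) es → (∀ {x} → x ∈ W → x ∉ S) →
                    (∀ {v} → v ∈ A ─ S ─ W → 3 ≤ deg v es) →
                    3 * ∣ A ─ S ─ W ∣ ≤ edgesWithin (A ─ W) es + edgesWithin (A ─ S) es
  three∣C∣≤edges {A} {S} {W} es edges⊆A W∩S=∅ 3≤deg = begin
    3 * ∣ C ∣                                       ≡⟨ cong (3 *_) (∣p∣≡sum-χ C) ⟩
    3 * sum (χ C)                                   ≡⟨ *-distribˡ-sum 3 (χ C) ⟩
    sum (λ v → 3 * χ C v)                           ≤⟨ sum-mono-≤ 3χ≤χdeg ⟩
    sum (λ v → χ C v * deg v es)                    ≡⟨ sum-*deg (χ C) es ⟩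
    sum (λ p → χ C (proj₁ (List.lookup es p)) + χ C (proj₂ (List.lookup es p)))
                                                    ≤⟨ sum-mono-≤ (λ p → ends∈C≤within W∩S=∅ (All.lookup edges⊆A (∈-lookup p))) ⟩
    sum (λ p → within (A ─ W) (List.lookup es p) + within (A ─ S) (List.lookup es p))
                                                    ≡⟨ ∑-distrib-+ (λ p → within (A ─ W) (List.lookup es p)) _ ⟩
    edgesWithin (A ─ W) es + edgesWithin (A ─ S) es ∎
    where
    open ℕP.≤-Reasoning
    C : Subset n
    C = A ─ S ─ W
    3χ≤χdeg : ∀ v → 3 * χ C v ≤ χ C v * deg v es
    3χ≤χdeg v with v ∈? C
    ... | no v∉C rewrite ∉⇒χ≡0 v∉C = z≤n
    ... | yes v∈C rewrite ∈⇒χ≡1 v∈C = ℕP.≤-trans (3≤deg v∈C) (ℕP.≤-reflexive (sym (ℕP.+-identityʳ _)))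

  -- With C = A ─ S ─ W: 3 ∣C∣ ≤ e(A ─ W) + e(A ─ S) ≤ (∣C∣ + ∣S∣) + (∣C∣ + ∣W∣), both being forests.
  degree3-count : ∀ {A S W : Subset n} (es : List (Edge n)) →
    All (Ends∈ A) es → W ⊆ A ─ S → (∀ {x} → x ∈ W → x ∉ S) → S ⊆ A ─ W →
    ¬ DartCycle (_∈ A ─ W) es → ¬ DartCycle (_∈ A ─ S) es → (∀ {v} → v ∈ A ─ S → 3 ≤ deg v es) →
    ∣ A ─ S ∣ ≤ ∣ S ∣ + 2 * ∣ W ∣
  degree3-count {A} {S} {W} es edges⊆A W⊆A─S W∩S=∅ S⊆A─W acyclic-W acyclic-S 3≤deg = begin
    ∣ A ─ S ∣             ≡⟨ |A─S| ⟩
    ∣ C ∣ + ∣ W ∣          ≤⟨ ℕP.+-monoˡ-≤ ∣ W ∣ |C|≤|S|+|W| ⟩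
    ∣ S ∣ + ∣ W ∣ + ∣ W ∣  ≡⟨ arith₃ (∣ S ∣) (∣ W ∣) ⟩
    ∣ S ∣ + 2 * ∣ W ∣      ∎
    where
    open ℕP.≤-Reasoning
    arith₁ : ∀ c → 3 * c ≡ 2 * c + c
    arith₁ = solve-∀
    arith₂ : ∀ c s w → (c + s) + (c + w) ≡ 2 * c + (s + w)
    arith₂ = solve-∀
    arith₃ : ∀ s w → s + w + w ≡ s + 2 * w
    arith₃ = solve-∀
    C : Subset n
    C = A ─ S ─ W
    |A─S| : ∣ A ─ S ∣ ≡ ∣ C ∣ + ∣ W ∣
    |A─S| = ∣p∣≡∣p─q∣+∣q∣ W⊆A─S
    |A─W| : ∣ A ─ W ∣ ≡ ∣ C ∣ + ∣ S ∣
    |A─W| = trans (∣p∣≡∣p─q∣+∣q∣ S⊆A─W) (cong (λ p → ∣ p ∣ + ∣ S ∣) (p─q─r≡p─r─q A W S))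
    3|C|≤ : 3 * ∣ C ∣ ≤ (∣ C ∣ + ∣ S ∣) + (∣ C ∣ + ∣ W ∣)
    3|C|≤ = begin
      3 * ∣ C ∣                                       ≤⟨ three∣C∣≤edges es edges⊆A W∩S=∅ (3≤deg ∘ p─q⊆p (A ─ S) W) ⟩
      edgesWithin (A ─ W) es + edgesWithin (A ─ S) es ≤⟨ ℕP.+-mono-≤ (acyclic⇒edgesWithin≤ _ (A ─ W) es refl acyclic-W)
                                                                     (acyclic⇒edgesWithin≤ _ (A ─ S) es refl acyclic-S) ⟩
      ∣ A ─ W ∣ + ∣ A ─ S ∣                           ≡⟨ cong₂ _+_ |A─W| |A─S| ⟩
      (∣ C ∣ + ∣ S ∣) + (∣ C ∣ + ∣ W ∣)               ∎
    |C|≤|S|+|W| : ∣ C ∣ ≤ ∣ S ∣ + ∣ W ∣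
    |C|≤|S|+|W| = ℕP.+-cancelˡ-≤ (2 * ∣ C ∣) _ _
                    (subst₂ _≤_ (arith₁ (∣ C ∣)) (arith₂ (∣ C ∣) (∣ S ∣) (∣ W ∣)) 3|C|≤)

module _ {n} {E : List (Edge n)} where

  -- a feedback vertex set no larger than X′ is minimum, so it cannot overlap X in more than R
  maxOverlap-∩⊆ : ∀ {X X′ R Z : Subset n} → IsMaxOverlap E X X′ → X ∩ X′ ≡ R →
                  R ⊆ X ∩ Z → IsFVS E Z → ∣ Z ∣ ≤ ∣ X′ ∣ → X ∩ Z ⊆ R
  maxOverlap-∩⊆ {X} {X′} {R} {Z} ((_ , X′-min) , X′-max) X∩X′≡R R⊆X∩Z Z-fvs |Z|≤|X′| {x} x∈X∩Z
    with x ∈? R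
  ... | yes x∈R = x∈R
  ... | no x∉R = contradiction
    (subst (∣ X ∩ Z ∣ ≤_) (cong ∣_∣ X∩X′≡R)
      (X′-max Z (Z-fvs , λ Y Y-fvs → ℕP.≤-trans |Z|≤|X′| (X′-min Y Y-fvs))))
    (ℕP.<⇒≱ (p⊂q⇒∣p∣<∣q∣ (R⊆X∩Z , x , x∈X∩Z , x∉R)))

  minimum-─ : ∀ {X X′ R : Subset n} → IsMinFVS E X′ → IsFVS E X → R ⊆ X′ → R ⊆ X →
              ∣ X′ ─ R ∣ ≤ ∣ X ─ R ∣
  minimum-─ {X} {X′} {R} (_ , X′-min) X-fvs R⊆X′ R⊆X = ℕP.+-cancelʳ-≤ ∣ R ∣ _ _
    (subst₂ _≤_ (∣p∣≡∣p─q∣+∣q∣ R⊆X′) (∣p∣≡∣p─q∣+∣q∣ R⊆X) (X′-min X X-fvs))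

-- What the reduction preserves

module Reduction {n} (E : List (Edge n)) (R S : Subset n) (S∩R=∅ : ∀ {x} → x ∈ S → x ∉ R) where

  -- cycles of H are cycles of G up to vertices already deleted, and cycles of G − R survive in H
  record Invariant (H : MG n) : Set₁ where
    field
      edges⊆alive : All (Ends∈ (alive H)) (edges H)
      S⊆alive     : S ⊆ alive H
      alive∩R=∅   : ∀ {x} → x ∈ alive H → x ∉ R
      cycle⁻      : ∀ {P : Fin n → Set} → (∀ {u} → P u → u ∈ alive H) → DartCycle P (edges H) →
                    DartCycle (λ u → P u ⊎ (u ∉ alive H × u ∉ R)) E
      cycle⁺      : ∀ {P : Fin n → Set} → (∀ {u} → P u → u ∉ R) → DartCycle P E → DartCycle P (edges H)

  invariant-induced : Invariant (induced E R)
  invariant-induced = record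
    { edges⊆alive = subst (All _) (sym (keepOutside-filter R E))
        (All.map (Product.map x∉p⇒x∈∁p x∉p⇒x∈∁p) (AllP.all-filter (outside? R) E))
    ; S⊆alive = x∉p⇒x∈∁p ∘ S∩R=∅
    ; alive∩R=∅ = x∈∁p⇒x∉p
    ; cycle⁻ = λ _ → mapCycle inj₁ ∘ keepOutsideCycle⁻
    ; cycle⁺ = keepOutsideCycle⁺ }

  invariant-step : ∀ {H H′} → Invariant H → Step S H H′ → Invariant H′
  invariant-step {mg A es} I (rule1 v v∈A v∉S deg≤1) = record
    { edges⊆alive = subst (All _) (sym (dropIncident-filter v es))
        (All.map (λ (ends∈A , ¬v∈e) → ends∈-remove ends∈A ¬v∈e)
          (All.zip (AllP.filter⁺ (¬? ∘ incident? v) edges⊆alive , AllP.all-filter (¬? ∘ incident? v) es)))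
    ; S⊆alive = λ x∈S → x∈p∧x≢y⇒x∈p-y (S⊆alive x∈S) (λ { refl → v∉S x∈S })
    ; alive∩R=∅ = alive∩R=∅ ∘ proj₁ ∘ x∈p-y⁻
    ; cycle⁻ = λ P⊆A′ →
        mapCycle (Sum.map₂ (Product.map₁ (λ u∉A u∈A′ → u∉A (proj₁ (x∈p-y⁻ u∈A′))))) ∘
        cycle⁻ (proj₁ ∘ x∈p-y⁻ ∘ P⊆A′) ∘ dropIncidentCycle⁻
    ; cycle⁺ = λ P∌R → dropIncidentCycle⁺ ∘ avoidsLowDegree deg≤1 ∘ cycle⁺ P∌R }
    where open Invariant I
  invariant-step {mg A es} I (rule2 {rest = rest} v a b v∈A v∉S perm j₁ j₂ a≢v b≢v rest∌v) = record
    { edges⊆alive = (x∈p∧x≢y⇒x∈p-y a∈A a≢v , x∈p∧x≢y⇒x∈p-y b∈A b≢v) ∷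
                    All.zipWith (λ (ends∈A , ¬v∈e) → ends∈-remove ends∈A ¬v∈e) (rest⊆A , rest∌v)
    ; S⊆alive = λ x∈S → x∈p∧x≢y⇒x∈p-y (S⊆alive x∈S) (λ { refl → v∉S x∈S })
    ; alive∩R=∅ = alive∩R=∅ ∘ proj₁ ∘ x∈p-y⁻
    ; cycle⁻ = λ P⊆A′ →
        mapCycle (λ { (inj₁ (inj₁ pu)) → inj₁ pu
                    ; (inj₁ (inj₂ refl)) → inj₂ ((λ v∈A′ → proj₂ (x∈p-y⁻ v∈A′) refl) , alive∩R=∅ v∈A)
                    ; (inj₂ (u∉A , u∉R)) → inj₂ ((λ u∈A′ → u∉A (proj₁ (x∈p-y⁻ u∈A′))) , u∉R) }) ∘
        cycle⁻ (λ { (inj₁ pu) → proj₁ (x∈p-y⁻ (P⊆A′ pu)) ; (inj₂ refl) → v∈A }) ∘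
        Rule2.cycle⁻ v a b perm j₁ j₂ a≢v b≢v rest∌v (proj₂ ∘ x∈p-y⁻ ∘ P⊆A′)
    ; cycle⁺ = λ P∌R → Rule2.cycle⁺ v a b perm j₁ j₂ a≢v b≢v rest∌v ∘ cycle⁺ P∌R }
    where
    open Invariant I
    edges₂⊆A : All (Ends∈ A) (_ ∷ _ ∷ rest)
    edges₂⊆A = PermP.All-resp-↭ perm edges⊆alive
    a∈A : a ∈ A
    a∈A = joins⇒∈ʳ (All.head edges₂⊆A) j₁
    b∈A : b ∈ A
    b∈A = joins⇒∈ʳ (All.head (All.tail edges₂⊆A)) j₂
    rest⊆A : All (Ends∈ A) rest
    rest⊆A = All.tail (All.tail edges₂⊆A)

  invariant* : ∀ {H H′} → Invariant H → Star (Step S) H H′ → Invariant H′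
  invariant* I ε = I
  invariant* I (s ◅ ss) = invariant* (invariant-step I s) ss

  record SmallFVS (H : MG n) (k : ℕ) : Set where
    field
      W       : Subset n
      W⊆alive : W ⊆ alive H
      |W|≤k   : ∣ W ∣ ≤ k
      acyclic : ¬ DartCycle (λ u → u ∈ alive H × u ∉ W) (edges H)

  smallFVS-step : ∀ {H H′ k} → Invariant H → Step S H H′ → SmallFVS H k → SmallFVS H′ k
  smallFVS-step I (rule1 v v∈A v∉S deg≤1) F = record
    { W = W - v
    ; W⊆alive = p-x⊆q-x W⊆alive
    ; |W|≤k = ℕP.≤-trans (∣p─q∣≤∣p∣ W ⁅ v ⁆) |W|≤k
    ; acyclic = acyclic ∘ dropIncidentCycle⁻ ∘ mapCycle ∈p-x∧∉q-x⇒∈p∧∉q }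
    where open SmallFVS F
  smallFVS-step {mg A es} I s@(rule2 v a b v∈A v∉S perm j₁ j₂ a≢v b≢v rest∌v) F with v ∈? SmallFVS.W F
  ... | yes v∈W = record
    { W = (W - v) ∪ ⁅ a ⁆
    ; W⊆alive = λ x∈W′ → Sum.[ p-x⊆q-x W⊆alive , (λ x∈⁅a⁆ → subst (_∈ A - v) (sym (x∈⁅y⁆⇒x≡y a x∈⁅a⁆)) a∈A-v) ]
                                 (x∈p∪q⁻ _ _ x∈W′)
    ; |W|≤k = begin
        ∣ (W - v) ∪ ⁅ a ⁆ ∣       ≤⟨ ∣p∪q∣≤∣p∣+∣q∣ (W - v) ⁅ a ⁆ ⟩
        ∣ W - v ∣ + ∣ ⁅ a ⁆ ∣     ≡⟨ cong (∣ W - v ∣ +_) (∣⁅x⁆∣≡1 a) ⟩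
        ∣ W - v ∣ + 1             ≡⟨ ℕP.+-comm (∣ W - v ∣) 1 ⟩
        suc ∣ W - v ∣             ≡⟨ ∣p∣≡1+∣p-x∣ v∈W ⟨
        ∣ W ∣                     ≤⟨ |W|≤k ⟩
        _                         ∎
    ; acyclic = acyclic ∘ mapCycle (λ (u∈A-v , u∉W′) → ∈p-x∧∉q-x⇒∈p∧∉q (u∈A-v , u∉W′ ∘ x∈p∪q⁺ ∘ inj₁)) ∘
        Rule2.cycle⁻-∌a v a b perm j₁ j₂ a≢v b≢v rest∌v (λ (_ , a∉W′) → a∉W′ (x∈p∪q⁺ (inj₂ (x∈⁅x⁆ a)))) }
    where
    open SmallFVS F
    open ℕP.≤-Reasoning
    a∈A-v : a ∈ A - v
    a∈A-v = proj₁ (All.head (Invariant.edges⊆alive (invariant-step I s)))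
  ... | no v∉W = record
    { W = W
    ; W⊆alive = λ x∈W → x∈p∧x≢y⇒x∈p-y (W⊆alive x∈W) (λ { refl → v∉W x∈W })
    ; |W|≤k = |W|≤k
    ; acyclic = acyclic ∘
        mapCycle (λ { (inj₁ (u∈A-v , u∉W)) → proj₁ (x∈p-y⁻ u∈A-v) , u∉W ; (inj₂ refl) → v∈A , v∉W }) ∘
        Rule2.cycle⁻ v a b perm j₁ j₂ a≢v b≢v rest∌v (proj₂ ∘ x∈p-y⁻ ∘ proj₁) }
    where open SmallFVS F

  smallFVS* : ∀ {H H′ k} → Invariant H → Star (Step S) H H′ → SmallFVS H k → SmallFVS H′ k
  smallFVS* I ε F = F
  smallFVS* I (s ◅ ss) F = smallFVS* (invariant-step I s) ss (smallFVS-step I s F)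

  initialFVS : ∀ {X′} → IsFVS E X′ → SmallFVS (induced E R) ∣ X′ ─ R ∣
  initialFVS {X′} X′-fvs = record
    { W = X′ ─ R
    ; W⊆alive = x∉p⇒x∈∁p ∘ x∈p─q⇒x∉q
    ; |W|≤k = ℕP.≤-refl
    ; acyclic = X′-fvs ∘ toCycle ∘ keepOutsideCycle⁻ ∘
        mapCycle (λ (u∈∁R , u∉X′─R) → x∉p⇒x∈∁p (λ u∈X′ → u∉X′─R (x∈p∧x∉q⇒x∈p─q u∈X′ (x∈∁p⇒x∉p u∈∁R)))) }

  -- a cycle of G avoiding W ∪ R survives in H, where it avoids W
  fvs-lift : ∀ {H k} → Invariant H → (F : SmallFVS H k) → IsFVS E (SmallFVS.W F ∪ R)
  fvs-lift I F c = SmallFVS.acyclic F (mapCycle avoidsW (restrictCycle c′ (cycle⊆ (Invariant.edges⊆alive I) c′)))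
    where
    avoids : ∀ {u} → u ∈ ∁ (SmallFVS.W F ∪ R) → u ∉ SmallFVS.W F × u ∉ R
    avoids u∈∁ = (x∈∁p⇒x∉p u∈∁ ∘ x∈p∪q⁺ ∘ inj₁) , (x∈∁p⇒x∉p u∈∁ ∘ x∈p∪q⁺ ∘ inj₂)
    c′ = Invariant.cycle⁺ I (proj₂ ∘ avoids) (fromCycle c)
    avoidsW : ∀ {u} → u ∈ ∁ (SmallFVS.W F ∪ R) × u ∈ _ → u ∈ _ × u ∉ SmallFVS.W F
    avoidsW (u∈∁ , u∈A) = u∈A , proj₁ (avoids u∈∁)

  acyclic-minus-S : ∀ {X H} → IsFVS E X → (∀ {u} → u ∉ R → u ∉ S → u ∉ X) → Invariant H →
                    ¬ DartCycle (λ u → u ∈ alive H × u ∉ S) (edges H)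
  acyclic-minus-S {X} {H} X-fvs X⊆S∪R I = X-fvs ∘ toCycle ∘ mapCycle outsideX ∘ cycle⁻ proj₁
    where
    open Invariant I
    outsideX : ∀ {u} → (u ∈ alive H × u ∉ S) ⊎ (u ∉ alive H × u ∉ R) → u ∈ ∁ X
    outsideX (inj₁ (u∈A , u∉S)) = x∉p⇒x∈∁p (X⊆S∪R (alive∩R=∅ u∈A) u∉S)
    outsideX (inj₂ (u∉A , u∉R)) = x∉p⇒x∈∁p (X⊆S∪R u∉R (u∉A ∘ S⊆alive))

  reduced-bound : ∀ {H k} → Invariant H → (∀ H′ → ¬ Step S H H′) →
                  ¬ DartCycle (λ u → u ∈ alive H × u ∉ S) (edges H) →
                  (F : SmallFVS H k) → (∀ {x} → x ∈ SmallFVS.W F → x ∉ S) → k ≤ ∣ S ∣ →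
                  ∣ alive H ─ S ∣ ≤ 3 * ∣ S ∣
  reduced-bound {mg A es} {k} I irreducible acyclic-S F W∩S=∅ k≤|S| = begin
    ∣ A ─ S ∣              ≤⟨ degree3-count es edges⊆alive W⊆A─S W∩S=∅ S⊆A─W
                                (acyclic ∘ mapCycle x∈p─q⁻) (acyclic-S ∘ mapCycle x∈p─q⁻)
                                (λ v∈A─S → let v∈A , v∉S = x∈p─q⁻ v∈A─S in
                                           irreducible⇒3≤deg irreducible v∈A v∉S acyclic-S) ⟩
    ∣ S ∣ + 2 * ∣ W ∣      ≤⟨ ℕP.+-monoʳ-≤ ∣ S ∣ (ℕP.*-monoʳ-≤ 2 (ℕP.≤-trans |W|≤k k≤|S|)) ⟩
    ∣ S ∣ + 2 * ∣ S ∣      ≡⟨ arith (∣ S ∣) ⟩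
    3 * ∣ S ∣              ∎
    where
    open ℕP.≤-Reasoning
    open Invariant I
    open SmallFVS F
    arith : ∀ s → s + 2 * s ≡ 3 * s
    arith = solve-∀
    W⊆A─S : W ⊆ A ─ S
    W⊆A─S x∈W = x∈p∧x∉q⇒x∈p─q (W⊆alive x∈W) (W∩S=∅ x∈W)
    S⊆A─W : S ⊆ A ─ W
    S⊆A─W x∈S = x∈p∧x∉q⇒x∈p─q (S⊆alive x∈S) (λ x∈W → W∩S=∅ x∈W x∈S)

  -- W ∪ R is a feedback vertex set of G no larger than X′
  smallFVS∩X⊆R : ∀ {X X′ H} → IsMaxOverlap E X X′ → X ∩ X′ ≡ R → R ⊆ X → R ⊆ X′ → Invariant H →
                 (F : SmallFVS H ∣ X′ ─ R ∣) → ∀ {x} → x ∈ X → x ∈ SmallFVS.W F → x ∈ R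
  smallFVS∩X⊆R {X} {X′} maxOverlap X∩X′≡R R⊆X R⊆X′ I F x∈X x∈W =
    maxOverlap-∩⊆ maxOverlap X∩X′≡R (λ x∈R → x∈p∩q⁺ (R⊆X x∈R , x∈p∪q⁺ (inj₂ x∈R))) (fvs-lift I F) |W∪R|≤|X′|
      (x∈p∩q⁺ (x∈X , x∈p∪q⁺ (inj₁ x∈W)))
    where
    open SmallFVS F
    |W∪R|≤|X′| : ∣ W ∪ R ∣ ≤ ∣ X′ ∣
    |W∪R|≤|X′| = ℕP.≤-trans (∣p∪q∣≤∣p∣+∣q∣ W R)
                   (ℕP.≤-trans (ℕP.+-monoˡ-≤ ∣ R ∣ |W|≤k) (ℕP.≤-reflexive (sym (∣p∣≡∣p─q∣+∣q∣ R⊆X′))))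

lemma10 : ∀ {n} (E : List (Edge n)) → SimpleGraph E →
    (X R : Subset n) → IsFVS E X → R ⊆ X →
    (∃ λ X' → IsMaxOverlap E X X' × (X ∩ X') ≡ R) →
    ∀ (H : MG n) → IsReduced E R (X ─ R) H →
    ∣ alive H ─ (X ─ R) ∣ ≤ 13 * ∣ X ─ R ∣
lemma10 E _ X R X-fvs R⊆X (X′ , maxOverlap@(X′-min@(X′-fvs , _) , _) , X∩X′≡R) H (reduces , irreducible) =
  ℕP.≤-trans (reduced-bound I irreducible (acyclic-minus-S X-fvs X⊆S∪R I) F W∩S=∅
                (minimum-─ X′-min X-fvs R⊆X′ R⊆X))
             (ℕP.*-monoˡ-≤ ∣ X ─ R ∣ (ℕP.m≤m+n 3 10))
  where
  S = X ─ R
  open Reduction E R S x∈p─q⇒x∉q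
  I = invariant* invariant-induced reduces
  F = smallFVS* invariant-induced reduces (initialFVS X′-fvs)
  R⊆X′ : R ⊆ X′
  R⊆X′ x∈R = proj₂ (x∈p∩q⁻ X X′ (subst (_ ∈_) (sym X∩X′≡R) x∈R))
  X⊆S∪R : ∀ {u} → u ∉ R → u ∉ S → u ∉ X
  X⊆S∪R u∉R u∉S u∈X = u∉S (x∈p∧x∉q⇒x∈p─q u∈X u∉R)
  W∩S=∅ : ∀ {x} → x ∈ SmallFVS.W F → x ∉ S
  W∩S=∅ x∈W x∈S = x∈p─q⇒x∉q x∈S (smallFVS∩X⊆R maxOverlap X∩X′≡R R⊆X R⊆X′ I F (p─q⊆p X R x∈S) x∈W)
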